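{- Let $t\ge 1$ and $\ell\ge 0$ be integers, let $n_1,\dots,n_t\ge 1$ and $m_1,\dots,m_\ell\ge 2$ be integers. Then \[b_2(C_{2n_1+1}+\dots+C_{2n_t+1}+C_{2m_1}+\dots+C_{2m_\ell})=(n_1+\dots+n_t)+(m_1+\dots+m_\ell)-\ell+1.\]
   Context: $C_r$ denotes the cycle on $r$ vertices and $G+H$ the disjoint union of graphs. An odd cover of a graph $G$ is a collection of complete bipartite graphs with disjoint parts $(X,Y)$, $X,Y\subseteq V(G)$, such that each edge of $G$ is covered (one endpoint in $X$, the other in $Y$) by an odd number of them and each nonedge by an even number; $b_2(G)$ is the minimum cardinality of an odd cover of $G$. -}

module Defs where

open import Data.Nat using (ℕ; zero; suc; _+_; _*_; _∸_; _%_; _≤_)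
open import Data.Bool using (Bool; true; false; _∧_; _∨_; not; if_then_else_)
open import Data.Fin using (Fin; toℕ; splitAt)
open import Data.Sum using (_⊎_; inj₁; inj₂)
open import Data.List using (List; []; _∷_; length; map; foldr)
open import Data.Product using (_×_; _,_; Σ; proj₁; proj₂)
open import Relation.Nullary using (¬_)
open import Relation.Nullary.Decidable using (⌊_⌋)
open import Relation.Binary.PropositionalEquality using (_≡_)
import Data.Nat as ℕ
import Data.Fin as Fin

-- A finite simple graph on vertex set Fin size, given by a Boolean adjacency
-- relation (symmetry/irreflexivity hold for all graphs built below).
record Graph : Set where
  constructor mkGraph
  field
    size : ℕ
    adj  : Fin size → Fin size → Bool
open Graph public

-- The cycle C_r on vertices 0,…,r-1 (used only for r ≥ 3):
-- i ~ j iff j = i+1, i = j+1, or {i,j} = {0, r-1}.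
cycleAdj : (r : ℕ) → Fin r → Fin r → Bool
cycleAdj r i j =
     ⌊ toℕ j ℕ.≟ suc (toℕ i) ⌋
  ∨ ⌊ toℕ i ℕ.≟ suc (toℕ j) ⌋
  ∨ (⌊ toℕ i ℕ.≟ 0 ⌋ ∧ ⌊ toℕ j ℕ.≟ r ∸ 1 ⌋)
  ∨ (⌊ toℕ j ℕ.≟ 0 ⌋ ∧ ⌊ toℕ i ℕ.≟ r ∸ 1 ⌋)

C : ℕ → Graph
C r = mkGraph r (cycleAdj r)

_⊕_ : Graph → Graph → Graph
G ⊕ H = mkGraph (size G + size H) a
  where
  a : Fin (size G + size H) → Fin (size G + size H) → Bool
  a u v with splitAt (size G) u | splitAt (size G) v
  ... | inj₁ x | inj₁ y = adj G x y
  ... | inj₂ x | inj₂ y = adj H x y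
  ... | inj₁ _ | inj₂ _ = false
  ... | inj₂ _ | inj₁ _ = false

emptyGraph : Graph
emptyGraph = mkGraph 0 (λ ())

⨁ : List Graph → Graph
⨁ = foldr _⊕_ emptyGraph

Subset : ℕ → Set
Subset n = Fin n → Bool

Biclique : ℕ → Set
Biclique n = Subset n × Subset n

Disjoint : {n : ℕ} → Biclique n → Set
Disjoint {n} (X , Y) = (v : Fin n) → X v ∧ Y v ≡ false

covers : {n : ℕ} → Biclique n → Fin n → Fin n → Bool
covers (X , Y) u v = (X u ∧ Y v) ∨ (X v ∧ Y u)

coverCount : {n : ℕ} → List (Biclique n) → Fin n → Fin n → ℕ
coverCount [] u v = 0
coverCount (B ∷ Bs) u v = (if covers B u v then 1 else 0) + coverCount Bs u v

data AllDisjoint {n : ℕ} : List (Biclique n) → Set where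
  []  : AllDisjoint []
  _∷_ : {B : Biclique n} {Bs : List (Biclique n)} →
        Disjoint B → AllDisjoint Bs → AllDisjoint (B ∷ Bs)

IsOddCover : (G : Graph) → List (Biclique (size G)) → Set
IsOddCover G Bs =
  AllDisjoint Bs ×
  ((u v : Fin (size G)) → ¬ (u ≡ v) →
     coverCount Bs u v % 2 ≡ (if adj G u v then 1 else 0))

b₂≡ : Graph → ℕ → Set
b₂≡ G k =
  Σ (List (Biclique (size G))) (λ Bs → IsOddCover G Bs × length Bs ≡ k)
  × ((Bs : List (Biclique (size G))) → IsOddCover G Bs → k ≤ length Bs)

{-# OPTIONS --safe #-}
module Submission where

-- Work over GF(2) = (Bool, xor, ∧).  A biclique (X , Y) with X ∩ Y = ∅ covers
-- {u , v} exactly when (X ⊗ Y) u v = X u Y v + X v Y u is 1, so an odd cover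
-- (Xᵢ , Yᵢ)ᵢ<k of G is a decomposition A = Σᵢ Xᵢ ⊗ Yᵢ of its adjacency matrix.
--
-- If w is orthogonal to all 2k sides Xᵢ, Yᵢ, then A w = 0 and w
-- induces an even number of edges, because Σ_{u<v} wᵤ w_v (X ⊗ Y) u v equals
-- (X·w)(Y·w) when X ∩ Y = ∅.  So a p-dimensional space of vectors, none of
-- which but 0 has both properties, injects into GF(2)^2k, and p ≤ 2k.  On a
-- cycle A w = 0 means wᵢ = wᵢ₊₂: on C_{2n+1} only 0 and the all-ones vector
-- (which induces an odd number of edges) remain, and pinning one vertex of an
-- odd or two adjacent vertices of an even cycle to 0 leaves only 0.  All
-- vertices of the first odd cycle and all but one or two vertices of each other
-- cycle give p = 2 (Σ nᵢ + Σ mⱼ - ℓ) + 1.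
--
-- C_{2m} is the sum of the m - 1 rungs ({0, 2j+2} , {2j+1, 2j+3}).
-- C_{2n+1} is the sum of n - 1 rungs, ({J} , {K}) and ({0} , {J, K}), where
-- J = 2n - 1 and K = 2n.  Next to a cover of the rest with a designated
-- biclique (P , Q) and family Rs such that P + Σ_{Rs} Y = Q, merge ({J} , {K})
-- into (P , Q) and put K into the X-side of every member of Rs: the cross terms
-- between the cycle and the rest then add up to K (P + Q + Σ_{Rs} Y)ᵀ = 0, so
-- every odd cycle after the first costs only n bicliques.

open import Algebra.Bundles using (CommutativeRing)
open import Data.Bool using (Bool; true; false; _∧_; _∨_; _xor_; not; if_then_else_)
import Data.Bool as 𝔹
open import Data.Bool.Properties
open import Data.Empty using (⊥-elim)
open import Data.Fin as Fin using (Fin; zero; suc; toℕ; splitAt; _↑ˡ_; _↑ʳ_)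
import Data.Fin.Properties as Finₚ
open import Data.List using (List; []; _∷_; length; map; _++_; lookup)
import Data.List.Properties as LP
open import Data.List.Relation.Unary.All as All using (All; []; _∷_)
import Data.List.Relation.Unary.All.Properties as All
open import Data.Maybe as Maybe using (Maybe; just; nothing; maybe′)
open import Data.Maybe.Properties using (maybe′-map)
open import Data.Nat as ℕ using (ℕ; zero; suc; _+_; _*_; _∸_; _^_; _≤_; _<_; _≡ᵇ_; _<ᵇ_; _%_)
open import Data.Nat.DivMod using (%-distribˡ-+)
open import Data.Nat.ListAction using (sum)
import Data.Nat.Properties as ℕₚ
import Data.Nat.Tactic.RingSolver as ℕ-Solver
open import Data.Product using (_×_; _,_; proj₁; proj₂; Σ-syntax)
open import Data.Sum as Sum using (_⊎_; inj₁; inj₂; [_,_]′)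
open import Data.Unit using (tt)
import Data.Vec.Functional as V
open import Function using (_∘_; Inverse)
open import Relation.Binary.PropositionalEquality
  using (_≡_; refl; sym; trans; cong; cong₂; subst; subst₂; module ≡-Reasoning)
open import Relation.Nullary using (¬_; yes; no)
open import Relation.Nullary.Decidable using (isYes≗does)
open import Tactic.RingSolver using (solve-∀)
open import Tactic.RingSolver.Core.AlmostCommutativeRing using (AlmostCommutativeRing; fromCommutativeRing)

open import Defs

open import Algebra.Properties.Semiring.Sum (CommutativeRing.semiring xor-∧-commutativeRing)
  using (sum-syntax; sum-cong-≗; sum-replicate-zero; ∑-distrib-+; ∑-comm; *-distribˡ-sum; *-distribʳ-sum)

private
  variable
    m n p q : ℕ

-- Sums over GF(2)

-- With this zero test the solver also knows 1 + 1 = 0.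
GF₂ : AlmostCommutativeRing _ _
GF₂ = fromCommutativeRing xor-∧-commutativeRing λ { false → just refl ; true → nothing }

∑-zero : ∀ {f : Fin n → Bool} → (∀ i → f i ≡ false) → ∑[ i < n ] f i ≡ false
∑-zero {n} f≗0 = trans (sum-cong-≗ f≗0) (sum-replicate-zero n)

∑-splitAt : ∀ m (f : Fin (m + n) → Bool) →
  ∑[ i < m + n ] f i ≡ ∑[ i < m ] f (i ↑ˡ n) xor ∑[ j < n ] f (m ↑ʳ j)
∑-splitAt zero    f = refl
∑-splitAt (suc m) f = trans (cong (f zero xor_) (∑-splitAt m (f ∘ suc))) (sym (xor-assoc (f zero) _ _))

∑-point : ∀ (f : Fin n → Bool) a → ∑[ v < n ] ((toℕ v ≡ᵇ toℕ a) ∧ f v) ≡ f a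
∑-point {suc n} f zero = trans (cong (f zero xor_) (sum-replicate-zero n)) (xor-identityʳ (f zero))
∑-point f (suc a) = ∑-point (f ∘ suc) a

∑∑-xor : (f g : Fin m → Fin n → Bool) →
  ∑[ u < m ] ∑[ v < n ] (f u v xor g u v) ≡ ∑[ u < m ] ∑[ v < n ] f u v xor ∑[ u < m ] ∑[ v < n ] g u v
∑∑-xor {m} {n} f g = trans (sum-cong-≗ λ u → ∑-distrib-+ (f u) (g u))
                           (∑-distrib-+ (λ u → ∑[ v < n ] f u v) (λ u → ∑[ v < n ] g u v))

∑ˡ : {A : Set} → List A → (A → Bool) → Bool
∑ˡ []       f = false
∑ˡ (x ∷ xs) f = f x xor ∑ˡ xs f

syntax ∑ˡ xs (λ x → e) = ∑[ x ∈ xs ] e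

∑ˡ-++ : {A : Set} (xs ys : List A) (f : A → Bool) → ∑ˡ (xs ++ ys) f ≡ ∑ˡ xs f xor ∑ˡ ys f
∑ˡ-++ []       ys f = refl
∑ˡ-++ (x ∷ xs) ys f = trans (cong (f x xor_) (∑ˡ-++ xs ys f)) (sym (xor-assoc (f x) _ _))

∑ˡ-map : {A B : Set} (g : A → B) (xs : List A) (f : B → Bool) → ∑ˡ (map g xs) f ≡ ∑ˡ xs (f ∘ g)
∑ˡ-map g []       f = refl
∑ˡ-map g (x ∷ xs) f = cong (f (g x) xor_) (∑ˡ-map g xs f)

∑ˡ-cong : {A : Set} (xs : List A) {f g : A → Bool} → (∀ x → f x ≡ g x) → ∑ˡ xs f ≡ ∑ˡ xs g
∑ˡ-cong []       f≗g = refl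
∑ˡ-cong (x ∷ xs) f≗g = cong₂ _xor_ (f≗g x) (∑ˡ-cong xs f≗g)

∑ˡ-zero : {A : Set} (xs : List A) {f : A → Bool} → (∀ x → f x ≡ false) → ∑ˡ xs f ≡ false
∑ˡ-zero []       f≗0 = refl
∑ˡ-zero (x ∷ xs) f≗0 = cong₂ _xor_ (f≗0 x) (∑ˡ-zero xs f≗0)

∑ˡ-∧ˡ : {A : Set} (a : Bool) (xs : List A) (f : A → Bool) → a ∧ ∑ˡ xs f ≡ ∑ˡ xs (λ x → a ∧ f x)
∑ˡ-∧ˡ a []       f = ∧-zeroʳ a
∑ˡ-∧ˡ a (x ∷ xs) f = trans (∧-distribˡ-xor a (f x) (∑ˡ xs f)) (cong ((a ∧ f x) xor_) (∑ˡ-∧ˡ a xs f))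

∨≡xor : ∀ {a b} → a ∧ b ≡ false → a ∨ b ≡ a xor b
∨≡xor {a} {b} a∧b≡false = sym (begin
  a xor b                  ≡⟨ xor-is-ok a b ⟩
  (a ∨ b) ∧ not (a ∧ b)    ≡⟨ cong (λ c → (a ∨ b) ∧ not c) a∧b≡false ⟩
  (a ∨ b) ∧ true           ≡⟨ ∧-identityʳ (a ∨ b) ⟩
  a ∨ b                    ∎)
  where open ≡-Reasoning

-- Bicliques as symmetric matrices

Matrix : ℕ → Set
Matrix n = Fin n → Fin n → Bool

_⊗_ : Subset n → Subset n → Matrix n
(X ⊗ Y) u v = (X u ∧ Y v) xor (X v ∧ Y u)

⟦_⟧ : Biclique n → Matrix n
⟦ X , Y ⟧ = X ⊗ Y

form : List (Biclique n) → Matrix n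
form Bs u v = ∑[ B ∈ Bs ] ⟦ B ⟧ u v

⊗-diagonal : (X Y : Subset n) (u : Fin n) → (X ⊗ Y) u u ≡ false
⊗-diagonal X Y u = xor-same (X u ∧ Y u)

⊗-emptyʳ : (X : Subset n) (u v : Fin n) → (X ⊗ (λ _ → false)) u v ≡ false
⊗-emptyʳ X u v = cong₂ _xor_ (∧-zeroʳ (X u)) (∧-zeroʳ (X v))

form-diagonal : (Bs : List (Biclique n)) (u : Fin n) → form Bs u u ≡ false
form-diagonal Bs u = ∑ˡ-zero Bs (λ (X , Y) → ⊗-diagonal X Y u)

covers≡⟦⟧ : (B : Biclique n) → Disjoint B → ∀ u v → covers B u v ≡ ⟦ B ⟧ u v
covers≡⟦⟧ (X , Y) disj u v = ∨≡xor {X u ∧ Y v} {X v ∧ Y u} (begin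
  (X u ∧ Y v) ∧ (X v ∧ Y u)  ≡⟨ regroup (X u) (Y v) (X v) (Y u) ⟩
  (X u ∧ Y u) ∧ (X v ∧ Y v)  ≡⟨ cong (_∧ (X v ∧ Y v)) (disj u) ⟩
  false                      ∎)
  where
  open ≡-Reasoning
  regroup : ∀ a b c d → (a ∧ b) ∧ (c ∧ d) ≡ (a ∧ d) ∧ (c ∧ b)
  regroup = solve-∀ GF₂

bit : Bool → ℕ
bit b = if b then 1 else 0

coverCount-parity : {Bs : List (Biclique n)} → AllDisjoint Bs → ∀ u v → coverCount Bs u v % 2 ≡ bit (form Bs u v)
coverCount-parity []                           u v = refl
coverCount-parity {Bs = (X , Y) ∷ Bs} (d ∷ ds) u v = begin
  (bit (covers (X , Y) u v) + coverCount Bs u v) % 2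
    ≡⟨ %-distribˡ-+ (bit (covers (X , Y) u v)) (coverCount Bs u v) 2 ⟩
  (bit (covers (X , Y) u v) % 2 + coverCount Bs u v % 2) % 2
    ≡⟨ cong₂ (λ a b → (bit a % 2 + b) % 2) (covers≡⟦⟧ (X , Y) d u v) (coverCount-parity ds u v) ⟩
  (bit ((X ⊗ Y) u v) % 2 + bit (form Bs u v)) % 2
    ≡⟨ bit-xor ((X ⊗ Y) u v) (form Bs u v) ⟩
  bit ((X ⊗ Y) u v xor form Bs u v) ∎
  where
  open ≡-Reasoning
  bit-xor : ∀ a b → (bit a % 2 + bit b) % 2 ≡ bit (a xor b)
  bit-xor false false = refl
  bit-xor false true  = refl
  bit-xor true  false = refl
  bit-xor true  true  = refl

bit-injective : ∀ {a b} → bit a ≡ bit b → a ≡ b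
bit-injective {false} {false} _ = refl
bit-injective {true}  {true}  _ = refl

Represents : (G : Graph) → List (Biclique (size G)) → Set
Represents G Bs = ∀ u v → ¬ u ≡ v → form Bs u v ≡ adj G u v

oddCover⇒represents : ∀ {G Bs} → IsOddCover G Bs → Represents G Bs
oddCover⇒represents {G} {Bs} (disj , odd) u v u≢v =
  bit-injective (trans (sym (coverCount-parity disj u v)) (odd u v u≢v))

represents⇒oddCover : ∀ {G Bs} → AllDisjoint Bs → Represents G Bs → IsOddCover G Bs
represents⇒oddCover disj rep = disj , λ u v u≢v → trans (coverCount-parity disj u v) (cong bit (rep u v u≢v))

record OddCover (G : Graph) (k : ℕ) : Set where
  field
    bicliques  : List (Biclique (size G))
    disjoint   : All Disjoint bicliques
    represents : Represents G bicliques
    length≡    : length bicliques ≡ k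

All⇒AllDisjoint : {Bs : List (Biclique n)} → All Disjoint Bs → AllDisjoint Bs
All⇒AllDisjoint []       = []
All⇒AllDisjoint (d ∷ ds) = d ∷ All⇒AllDisjoint ds

-- Null vectors and the lower bound

_·_ : Subset n → Subset n → Bool
_·_ {n} X w = ∑[ v < n ] (X v ∧ w v)

degree : Matrix n → Subset n → Subset n
degree {n} M w x = ∑[ v < n ] (w v ∧ M v x)

_<ᶠ_ : Fin n → Fin n → Bool
u <ᶠ v = toℕ u <ᵇ toℕ v

edgeParity : Matrix n → Subset n → Bool
edgeParity {n} M w = ∑[ u < n ] ∑[ v < n ] ((u <ᶠ v) ∧ (w u ∧ (w v ∧ M u v)))

degree-cong : {M N : Matrix n} {w w′ : Subset n} → (∀ u v → M u v ≡ N u v) → (∀ v → w v ≡ w′ v) →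
  ∀ x → degree M w x ≡ degree N w′ x
degree-cong M≗N w≗w′ x = sum-cong-≗ (λ v → cong₂ _∧_ (w≗w′ v) (M≗N v x))

edgeParity-cong : {M N : Matrix n} {w w′ : Subset n} → (∀ u v → M u v ≡ N u v) → (∀ v → w v ≡ w′ v) →
  edgeParity M w ≡ edgeParity N w′
edgeParity-cong M≗N w≗w′ = sum-cong-≗ λ u → sum-cong-≗ λ v →
  cong (λ a → (u <ᶠ v) ∧ a) (cong₂ _∧_ (w≗w′ u) (cong₂ _∧_ (w≗w′ v) (M≗N u v)))

degree-xor : (M N : Matrix n) (w : Subset n) (x : Fin n) →
  degree (λ u v → M u v xor N u v) w x ≡ degree M w x xor degree N w x
degree-xor M N w x = trans (sum-cong-≗ (λ v → ∧-distribˡ-xor (w v) (M v x) (N v x)))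
                           (∑-distrib-+ (λ v → w v ∧ M v x) (λ v → w v ∧ N v x))

edgeParity-xor : (M N : Matrix n) (w : Subset n) →
  edgeParity (λ u v → M u v xor N u v) w ≡ edgeParity M w xor edgeParity N w
edgeParity-xor M N w = trans (sum-cong-≗ λ u → sum-cong-≗ λ v → distrib (u <ᶠ v) (w u) (w v) (M u v) (N u v))
                             (∑∑-xor (T M) (T N))
  where
  T : Matrix _ → Fin _ → Fin _ → Bool
  T K u v = (u <ᶠ v) ∧ (w u ∧ (w v ∧ K u v))
  distrib : ∀ l a b c d → l ∧ (a ∧ (b ∧ (c xor d))) ≡ (l ∧ (a ∧ (b ∧ c))) xor (l ∧ (a ∧ (b ∧ d)))
  distrib = solve-∀ GF₂

degree-⊗ : (X Y w : Subset n) (x : Fin n) → degree (X ⊗ Y) w x ≡ ((X · w) ∧ Y x) xor (X x ∧ (Y · w))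
degree-⊗ X Y w x = begin
  ∑[ v < _ ] (w v ∧ ((X v ∧ Y x) xor (X x ∧ Y v)))
    ≡⟨ sum-cong-≗ (λ v → expand (w v) (X v) (Y x) (X x) (Y v)) ⟩
  ∑[ v < _ ] (((X v ∧ w v) ∧ Y x) xor (X x ∧ (Y v ∧ w v)))
    ≡⟨ ∑-distrib-+ (λ v → (X v ∧ w v) ∧ Y x) (λ v → X x ∧ (Y v ∧ w v)) ⟩
  ∑[ v < _ ] ((X v ∧ w v) ∧ Y x) xor ∑[ v < _ ] (X x ∧ (Y v ∧ w v))
    ≡⟨ sym (cong₂ _xor_ (*-distribʳ-sum (Y x) (λ v → X v ∧ w v)) (*-distribˡ-sum (X x) (λ v → Y v ∧ w v))) ⟩
  ((X · w) ∧ Y x) xor (X x ∧ (Y · w)) ∎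
  where
  open ≡-Reasoning
  expand : ∀ w a b c d → w ∧ ((a ∧ b) xor (c ∧ d)) ≡ ((a ∧ w) ∧ b) xor (c ∧ (d ∧ w))
  expand = solve-∀ GF₂

<ᵇ-trichotomy : ∀ i j → (i <ᵇ j) xor (j <ᵇ i) ≡ true xor (j ≡ᵇ i)
<ᵇ-trichotomy zero    zero    = refl
<ᵇ-trichotomy zero    (suc j) = refl
<ᵇ-trichotomy (suc i) zero    = refl
<ᵇ-trichotomy (suc i) (suc j) = <ᵇ-trichotomy i j

∑-offDiagonal : (f : Fin n → Fin n → Bool) →
  ∑[ u < n ] ∑[ v < n ] ((u <ᶠ v) ∧ f u v) xor ∑[ u < n ] ∑[ v < n ] ((u <ᶠ v) ∧ f v u)
    ≡ ∑[ u < n ] ∑[ v < n ] f u v xor ∑[ u < n ] f u u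
∑-offDiagonal {n} f = begin
  ∑[ u < n ] ∑[ v < n ] ((u <ᶠ v) ∧ f u v) xor ∑[ u < n ] ∑[ v < n ] ((u <ᶠ v) ∧ f v u)
    ≡⟨ cong (∑[ u < n ] ∑[ v < n ] ((u <ᶠ v) ∧ f u v) xor_) (∑-comm (λ u v → (u <ᶠ v) ∧ f v u)) ⟩
  ∑[ u < n ] ∑[ v < n ] ((u <ᶠ v) ∧ f u v) xor ∑[ u < n ] ∑[ v < n ] ((v <ᶠ u) ∧ f u v)
    ≡⟨ sym (∑∑-xor (λ u v → (u <ᶠ v) ∧ f u v) (λ u v → (v <ᶠ u) ∧ f u v)) ⟩
  ∑[ u < n ] ∑[ v < n ] (((u <ᶠ v) ∧ f u v) xor ((v <ᶠ u) ∧ f u v))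
    ≡⟨ sum-cong-≗ (λ u → sum-cong-≗ λ v → off (u <ᶠ v) (v <ᶠ u) (toℕ v ≡ᵇ toℕ u) (f u v)
                                                (<ᵇ-trichotomy (toℕ u) (toℕ v))) ⟩
  ∑[ u < n ] ∑[ v < n ] (f u v xor ((toℕ v ≡ᵇ toℕ u) ∧ f u v))
    ≡⟨ sum-cong-≗ (λ u → trans (∑-distrib-+ (f u) (λ v → (toℕ v ≡ᵇ toℕ u) ∧ f u v))
                               (cong (∑[ v < n ] f u v xor_) (∑-point (f u) u))) ⟩
  ∑[ u < n ] (∑[ v < n ] f u v xor f u u)
    ≡⟨ ∑-distrib-+ (λ u → ∑[ v < n ] f u v) (λ u → f u u) ⟩
  ∑[ u < n ] ∑[ v < n ] f u v xor ∑[ u < n ] f u u ∎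
  where
  open ≡-Reasoning
  off : ∀ l l′ e a → l xor l′ ≡ true xor e → (l ∧ a) xor (l′ ∧ a) ≡ a xor (e ∧ a)
  off l l′ e a tri = begin
    (l ∧ a) xor (l′ ∧ a)  ≡⟨ sym (∧-distribʳ-xor a l l′) ⟩
    (l xor l′) ∧ a        ≡⟨ cong (_∧ a) tri ⟩
    (true xor e) ∧ a      ≡⟨ expand e a ⟩
    a xor (e ∧ a)         ∎
    where
    expand : ∀ e a → (true xor e) ∧ a ≡ a xor (e ∧ a)
    expand = solve-∀ GF₂

edgeParity-⊗ : (X Y : Subset n) → Disjoint (X , Y) → (w : Subset n) → edgeParity (X ⊗ Y) w ≡ (X · w) ∧ (Y · w)
edgeParity-⊗ {n} X Y disj w = begin
  edgeParity (X ⊗ Y) w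
    ≡⟨ sum-cong-≗ (λ u → sum-cong-≗ λ v → split (u <ᶠ v) (w u) (w v) (X u) (Y v) (X v) (Y u)) ⟩
  ∑[ u < n ] ∑[ v < n ] (((u <ᶠ v) ∧ g u v) xor ((u <ᶠ v) ∧ g v u))
    ≡⟨ ∑∑-xor (λ u v → (u <ᶠ v) ∧ g u v) (λ u v → (u <ᶠ v) ∧ g v u) ⟩
  ∑[ u < n ] ∑[ v < n ] ((u <ᶠ v) ∧ g u v) xor ∑[ u < n ] ∑[ v < n ] ((u <ᶠ v) ∧ g v u)
    ≡⟨ ∑-offDiagonal g ⟩
  ∑[ u < n ] ∑[ v < n ] g u v xor ∑[ u < n ] g u u
    ≡⟨ cong₂ _xor_ product (∑-zero diagonal) ⟩
  ((X · w) ∧ (Y · w)) xor false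
    ≡⟨ xor-identityʳ _ ⟩
  (X · w) ∧ (Y · w) ∎
  where
  open ≡-Reasoning
  g : Fin n → Fin n → Bool
  g u v = (X u ∧ w u) ∧ (Y v ∧ w v)
  split : ∀ l a b x y x′ y′ → l ∧ (a ∧ (b ∧ ((x ∧ y) xor (x′ ∧ y′))))
                             ≡ (l ∧ ((x ∧ a) ∧ (y ∧ b))) xor (l ∧ ((x′ ∧ b) ∧ (y′ ∧ a)))
  split = solve-∀ GF₂
  product : ∑[ u < n ] ∑[ v < n ] g u v ≡ (X · w) ∧ (Y · w)
  product = trans (sum-cong-≗ (λ u → sym (*-distribˡ-sum (X u ∧ w u) (λ v → Y v ∧ w v))))
                  (sym (*-distribʳ-sum (Y · w) (λ u → X u ∧ w u)))
  diagonal : ∀ u → g u u ≡ false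
  diagonal u = begin
    (X u ∧ w u) ∧ (Y u ∧ w u)  ≡⟨ regroup (X u) (Y u) (w u) ⟩
    (X u ∧ Y u) ∧ (w u ∧ w u)  ≡⟨ cong (_∧ (w u ∧ w u)) (disj u) ⟩
    false                      ∎
    where
    regroup : ∀ x y w → (x ∧ w) ∧ (y ∧ w) ≡ (x ∧ y) ∧ (w ∧ w)
    regroup = solve-∀ GF₂

sides : List (Biclique n) → List (Subset n)
sides []             = []
sides ((X , Y) ∷ Bs) = X ∷ Y ∷ sides Bs

length-sides : (Bs : List (Biclique n)) → length (sides Bs) ≡ 2 * length Bs
length-sides []       = refl
length-sides (B ∷ Bs) = trans (cong (2 +_) (length-sides Bs)) (sym (ℕₚ.*-suc 2 (length Bs)))

signature : (Bs : List (Biclique n)) → Subset n → Fin (length (sides Bs)) → Bool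
signature Bs w i = lookup (sides Bs) i · w

degree-form≡false : (Bs : List (Biclique n)) (w : Subset n) → (∀ i → signature Bs w i ≡ false) →
  ∀ x → degree (form Bs) w x ≡ false
degree-form≡false []             w _  x = ∑-zero (λ v → ∧-zeroʳ (w v))
degree-form≡false ((X , Y) ∷ Bs) w σ≗0 x = begin
  degree (form ((X , Y) ∷ Bs)) w x
    ≡⟨ degree-xor (X ⊗ Y) (form Bs) w x ⟩
  degree (X ⊗ Y) w x xor degree (form Bs) w x
    ≡⟨ cong₂ _xor_ (degree-⊗ X Y w x) (degree-form≡false Bs w (λ i → σ≗0 (suc (suc i))) x) ⟩
  (((X · w) ∧ Y x) xor (X x ∧ (Y · w))) xor false
    ≡⟨ cong₂ (λ a b → ((a ∧ Y x) xor (X x ∧ b)) xor false) (σ≗0 zero) (σ≗0 (suc zero)) ⟩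
  false xor (X x ∧ false) xor false
    ≡⟨ cong (λ a → a xor false) (∧-zeroʳ (X x)) ⟩
  false ∎
  where open ≡-Reasoning

edgeParity-form≡false : {Bs : List (Biclique n)} → AllDisjoint Bs → (w : Subset n) → (∀ i → signature Bs w i ≡ false) →
  edgeParity (form Bs) w ≡ false
edgeParity-form≡false []                                w _ = ∑-zero λ u → ∑-zero λ v → zero-right (u <ᶠ v) (w u) (w v)
  where
  zero-right : ∀ l a b → l ∧ (a ∧ (b ∧ false)) ≡ false
  zero-right = solve-∀ GF₂
edgeParity-form≡false {Bs = (X , Y) ∷ Bs} (disj ∷ disjs) w σ≗0 = begin
  edgeParity (form ((X , Y) ∷ Bs)) w
    ≡⟨ edgeParity-xor (X ⊗ Y) (form Bs) w ⟩
  edgeParity (X ⊗ Y) w xor edgeParity (form Bs) w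
    ≡⟨ cong₂ _xor_ (edgeParity-⊗ X Y disj w) (edgeParity-form≡false disjs w (λ i → σ≗0 (suc (suc i)))) ⟩
  ((X · w) ∧ (Y · w)) xor false
    ≡⟨ cong₂ (λ a b → (a ∧ b) xor false) (σ≗0 zero) (σ≗0 (suc zero)) ⟩
  false ∎
  where open ≡-Reasoning

Irreflexive : Graph → Set
Irreflexive G = ∀ x → adj G x x ≡ false

Null : (G : Graph) → Subset (size G) → Set
Null G w = ∀ x → degree (adj G) w x ≡ false

EvenNull : (G : Graph) → Subset (size G) → Set
EvenNull G w = Null G w × edgeParity (adj G) w ≡ false

represents-everywhere : ∀ {G Bs} → Irreflexive G → Represents G Bs → ∀ u v → form Bs u v ≡ adj G u v
represents-everywhere {G} {Bs} irr rep u v with u Fin.≟ v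
... | yes refl = trans (form-diagonal Bs u) (sym (irr u))
... | no u≢v   = rep u v u≢v

signature≗0⇒EvenNull : ∀ {G Bs} → Irreflexive G → IsOddCover G Bs → (w : Subset (size G)) →
  (∀ i → signature Bs w i ≡ false) → EvenNull G w
signature≗0⇒EvenNull {G} {Bs} irr cover w σ≗0 =
    (λ x → trans (degree-cong {M = adj G} (λ u v → sym (form≗adj u v)) (λ _ → refl) x) (degree-form≡false Bs w σ≗0 x))
  , trans (edgeParity-cong {M = adj G} {w = w} (λ u v → sym (form≗adj u v)) (λ _ → refl))
          (edgeParity-form≡false (proj₁ cover) w σ≗0)
  where
  form≗adj : ∀ u v → form Bs u v ≡ adj G u v
  form≗adj = represents-everywhere {G} {Bs} irr (oddCover⇒represents {G} {Bs} cover)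

funToFin-cong : {f g : Fin m → Fin n} → (∀ i → f i ≡ g i) → Fin.funToFin f ≡ Fin.funToFin g
funToFin-cong {zero}  f≗g = refl
funToFin-cong {suc m} f≗g = cong₂ Fin.combine (f≗g zero) (funToFin-cong (f≗g ∘ suc))

^-cancelˡ-≤ : ∀ {p q} → 2 ^ p ≤ 2 ^ q → p ≤ q
^-cancelˡ-≤ 2^p≤2^q = ℕₚ.≮⇒≥ (λ q<p → ℕₚ.<⇒≱ (ℕₚ.^-monoʳ-< 2 (ℕ.s≤s (ℕ.s≤s ℕ.z≤n)) q<p) 2^p≤2^q)

boolVector-injective⇒≤ : (F : (Fin p → Bool) → (Fin q → Bool)) →
  (∀ c c′ → (∀ i → F c i ≡ F c′ i) → ∀ j → c j ≡ c′ j) → p ≤ q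
boolVector-injective⇒≤ {p} {q} F F-injective = ^-cancelˡ-≤ (Finₚ.injective⇒≤ code-injective)
  where
  open Inverse Finₚ.2↔Bool using (to; from; strictlyInverseˡ; strictlyInverseʳ)
  digits : Fin (2 ^ p) → Fin p → Fin 2
  digits = Fin.finToFun
  decode : Fin (2 ^ p) → Fin p → Bool
  decode k = to ∘ digits k
  code : Fin (2 ^ p) → Fin (2 ^ q)
  code k = Fin.funToFin (from ∘ F (decode k))
  code-injective : ∀ {k k′} → code k ≡ code k′ → k ≡ k′
  code-injective {k} {k′} eq = begin
    k                          ≡⟨ Finₚ.funToFin-finToFin {p} {2} k ⟨
    Fin.funToFin (digits k)    ≡⟨ funToFin-cong same-digits ⟩
    Fin.funToFin (digits k′)   ≡⟨ Finₚ.funToFin-finToFin {p} {2} k′ ⟩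
    k′                         ∎
    where
    open ≡-Reasoning
    same-image : ∀ i → F (decode k) i ≡ F (decode k′) i
    same-image i = begin
      F (decode k) i                    ≡⟨ strictlyInverseˡ _ ⟨
      to (from (F (decode k) i))        ≡⟨ cong to (Finₚ.finToFun-funToFin (from ∘ F (decode k)) i) ⟨
      to (Fin.finToFun (code k) i)      ≡⟨ cong (λ c → to (Fin.finToFun c i)) eq ⟩
      to (Fin.finToFun (code k′) i)     ≡⟨ cong to (Finₚ.finToFun-funToFin (from ∘ F (decode k′)) i) ⟩
      to (from (F (decode k′) i))       ≡⟨ strictlyInverseˡ _ ⟩
      F (decode k′) i                   ∎
    same-digits : ∀ j → digits k j ≡ digits k′ j
    same-digits j = begin
      digits k j             ≡⟨ strictlyInverseʳ _ ⟨
      from (decode k j)      ≡⟨ cong from (F-injective (decode k) (decode k′) same-image j) ⟩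
      from (decode k′ j)     ≡⟨ strictlyInverseʳ _ ⟩
      digits k′ j            ∎

-- Subspaces are presented by coordinate maps ι, which makes the embedding extend ι linear by construction.
extend : (Fin n → Maybe (Fin p)) → (Fin p → Bool) → Subset n
extend ι c v = maybe′ c false (ι v)

extend-xor : (ι : Fin n → Maybe (Fin p)) (c c′ : Fin p → Bool) →
  ∀ v → extend ι (λ j → c j xor c′ j) v ≡ extend ι c v xor extend ι c′ v
extend-xor ι c c′ v with ι v
... | just j  = refl
... | nothing = refl

·-xor : (X w w′ : Subset n) → X · (λ v → w v xor w′ v) ≡ X · w xor X · w′
·-xor X w w′ = trans (sum-cong-≗ λ v → ∧-distribˡ-xor (X v) (w v) (w′ v))
                     (∑-distrib-+ (λ v → X v ∧ w v) (λ v → X v ∧ w′ v))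

Avoids : (Subset n → Set) → (Fin n → Maybe (Fin p)) → Set
Avoids P ι = ∀ c → P (extend ι c) → ∀ j → c j ≡ false

xor≡false⇒≡ : ∀ {a b} → a xor b ≡ false → a ≡ b
xor≡false⇒≡ {false} {false} _ = refl
xor≡false⇒≡ {true}  {true}  _ = refl

NullFree : Graph → ℕ → Set
NullFree G p = Σ[ ι ∈ (Fin (size G) → Maybe (Fin p)) ] Avoids (Null G) ι

EvenNullFree : Graph → ℕ → Set
EvenNullFree G p = Σ[ ι ∈ (Fin (size G) → Maybe (Fin p)) ] Avoids (EvenNull G) ι

EvenNullFree⇒≤2*length : ∀ {G} → Irreflexive G → EvenNullFree G p → ∀ Bs → IsOddCover G Bs → p ≤ 2 * length Bs
EvenNullFree⇒≤2*length {G = G} irr (ι , avoids) Bs cover =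
  subst (_ ≤_) (length-sides Bs) (boolVector-injective⇒≤ (λ c → signature Bs (extend ι c)) injective)
  where
  injective : ∀ c c′ → (∀ i → signature Bs (extend ι c) i ≡ signature Bs (extend ι c′) i) → ∀ j → c j ≡ c′ j
  injective c c′ same = xor≡false⇒≡ ∘ avoids c⊕c′ (signature≗0⇒EvenNull {G} {Bs} irr cover (extend ι c⊕c′) σ≗0)
    where
    c⊕c′ : Fin _ → Bool
    c⊕c′ j = c j xor c′ j
    σ≗0 : ∀ i → signature Bs (extend ι c⊕c′) i ≡ false
    σ≗0 i = begin
      X · extend ι c⊕c′                                     ≡⟨ sum-cong-≗ (λ v → cong (X v ∧_) (extend-xor ι c c′ v)) ⟩
      X · (λ v → extend ι c v xor extend ι c′ v)            ≡⟨ ·-xor X (extend ι c) (extend ι c′) ⟩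
      X · extend ι c xor X · extend ι c′                    ≡⟨ cong (_xor X · extend ι c′) (same i) ⟩
      X · extend ι c′ xor X · extend ι c′                   ≡⟨ xor-same (X · extend ι c′) ⟩
      false                                                 ∎
      where
      open ≡-Reasoning
      X : Subset (size G)
      X = lookup (sides Bs) i

-- Disjoint unions

↑-elim : {P : Fin (m + n) → Set} → (∀ i → P (i ↑ˡ n)) → (∀ j → P (m ↑ʳ j)) → ∀ k → P k
↑-elim {m} {n} {P} Pˡ Pʳ k with splitAt m k in eq
... | inj₁ i = subst P (Finₚ.splitAt⁻¹-↑ˡ eq) (Pˡ i)
... | inj₂ j = subst P (Finₚ.splitAt⁻¹-↑ʳ eq) (Pʳ j)

edgeParity-zero : (M : Matrix n) → edgeParity M (λ _ → false) ≡ false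
edgeParity-zero {n} M = ∑-zero {f = λ u → ∑[ v < n ] ((u <ᶠ v) ∧ false)} λ u → ∑-zero λ v → ∧-zeroʳ (u <ᶠ v)

Null-resp : ∀ {G} {w w′ : Subset (size G)} → (∀ v → w v ≡ w′ v) → Null G w → Null G w′
Null-resp {G} w≗w′ null x = trans (degree-cong {M = adj G} (λ _ _ → refl) (sym ∘ w≗w′) x) (null x)

extend-zero : (ι : Fin n → Maybe (Fin p)) {c : Fin p → Bool} → (∀ j → c j ≡ false) → ∀ v → extend ι c v ≡ false
extend-zero ι c≗0 v with ι v
... | just j  = c≗0 j
... | nothing = refl

_⊕ᶜ_ : {a b : ℕ} → (Fin a → Maybe (Fin p)) → (Fin b → Maybe (Fin q)) → Fin (a + b) → Maybe (Fin (p + q))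
_⊕ᶜ_ {p} {q} {a} ι κ u = [ Maybe.map (_↑ˡ q) ∘ ι , Maybe.map (p ↑ʳ_) ∘ κ ]′ (splitAt a u)

module _ {a b : ℕ} (ι : Fin a → Maybe (Fin p)) (κ : Fin b → Maybe (Fin q)) (c : Fin (p + q) → Bool) where

  extend-↑ˡ : ∀ x → extend (ι ⊕ᶜ κ) c (x ↑ˡ b) ≡ extend ι (λ j → c (j ↑ˡ q)) x
  extend-↑ˡ x rewrite Finₚ.splitAt-↑ˡ a x b = maybe′-map c false (_↑ˡ q) (ι x)

  extend-↑ʳ : ∀ y → extend (ι ⊕ᶜ κ) c (a ↑ʳ y) ≡ extend κ (λ j → c (p ↑ʳ j)) y
  extend-↑ʳ y rewrite Finₚ.splitAt-↑ʳ a b y = maybe′-map c false (p ↑ʳ_) (κ y)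

module _ (G H : Graph) where
  private
    a b : ℕ
    a = size G
    b = size H

  adj-↑ˡ↑ˡ : ∀ x x′ → adj (G ⊕ H) (x ↑ˡ b) (x′ ↑ˡ b) ≡ adj G x x′
  adj-↑ˡ↑ˡ x x′ rewrite Finₚ.splitAt-↑ˡ a x b | Finₚ.splitAt-↑ˡ a x′ b = refl

  adj-↑ʳ↑ʳ : ∀ y y′ → adj (G ⊕ H) (a ↑ʳ y) (a ↑ʳ y′) ≡ adj H y y′
  adj-↑ʳ↑ʳ y y′ rewrite Finₚ.splitAt-↑ʳ a b y | Finₚ.splitAt-↑ʳ a b y′ = refl

  adj-↑ˡ↑ʳ : ∀ x y → adj (G ⊕ H) (x ↑ˡ b) (a ↑ʳ y) ≡ false
  adj-↑ˡ↑ʳ x y rewrite Finₚ.splitAt-↑ˡ a x b | Finₚ.splitAt-↑ʳ a b y = refl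

  adj-↑ʳ↑ˡ : ∀ y x → adj (G ⊕ H) (a ↑ʳ y) (x ↑ˡ b) ≡ false
  adj-↑ʳ↑ˡ y x rewrite Finₚ.splitAt-↑ʳ a b y | Finₚ.splitAt-↑ˡ a x b = refl

  Irreflexive-⊕ : Irreflexive G → Irreflexive H → Irreflexive (G ⊕ H)
  Irreflexive-⊕ irrG irrH = ↑-elim (λ x → trans (adj-↑ˡ↑ˡ x x) (irrG x)) (λ y → trans (adj-↑ʳ↑ʳ y y) (irrH y))

  degree-↑ˡ : ∀ w x → degree (adj (G ⊕ H)) w (x ↑ˡ b) ≡ degree (adj G) (λ x′ → w (x′ ↑ˡ b)) x
  degree-↑ˡ w x = begin
    degree (adj (G ⊕ H)) w (x ↑ˡ b)
      ≡⟨ ∑-splitAt a (λ u → w u ∧ adj (G ⊕ H) u (x ↑ˡ b)) ⟩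
    ∑[ x′ < a ] (w (x′ ↑ˡ b) ∧ adj (G ⊕ H) (x′ ↑ˡ b) (x ↑ˡ b)) xor ∑[ y < b ] (w (a ↑ʳ y) ∧ adj (G ⊕ H) (a ↑ʳ y) (x ↑ˡ b))
      ≡⟨ cong₂ _xor_ (sum-cong-≗ λ x′ → cong (w (x′ ↑ˡ b) ∧_) (adj-↑ˡ↑ˡ x′ x))
                     (∑-zero λ y → trans (cong (w (a ↑ʳ y) ∧_) (adj-↑ʳ↑ˡ y x)) (∧-zeroʳ _)) ⟩
    degree (adj G) (λ x′ → w (x′ ↑ˡ b)) x xor false
      ≡⟨ xor-identityʳ _ ⟩
    degree (adj G) (λ x′ → w (x′ ↑ˡ b)) x ∎
    where open ≡-Reasoning

  degree-↑ʳ : ∀ w y → degree (adj (G ⊕ H)) w (a ↑ʳ y) ≡ degree (adj H) (λ y′ → w (a ↑ʳ y′)) y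
  degree-↑ʳ w y = begin
    degree (adj (G ⊕ H)) w (a ↑ʳ y)
      ≡⟨ ∑-splitAt a (λ u → w u ∧ adj (G ⊕ H) u (a ↑ʳ y)) ⟩
    ∑[ x < a ] (w (x ↑ˡ b) ∧ adj (G ⊕ H) (x ↑ˡ b) (a ↑ʳ y)) xor ∑[ y′ < b ] (w (a ↑ʳ y′) ∧ adj (G ⊕ H) (a ↑ʳ y′) (a ↑ʳ y))
      ≡⟨ cong₂ _xor_ (∑-zero λ x → trans (cong (w (x ↑ˡ b) ∧_) (adj-↑ˡ↑ʳ x y)) (∧-zeroʳ _))
                     (sum-cong-≗ λ y′ → cong (w (a ↑ʳ y′) ∧_) (adj-↑ʳ↑ʳ y′ y)) ⟩
    degree (adj H) (λ y′ → w (a ↑ʳ y′)) y ∎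
    where open ≡-Reasoning

  <ᶠ-↑ˡ : ∀ (x x′ : Fin a) → (x ↑ˡ b) <ᶠ (x′ ↑ˡ b) ≡ x <ᶠ x′
  <ᶠ-↑ˡ x x′ rewrite Finₚ.toℕ-↑ˡ x b | Finₚ.toℕ-↑ˡ x′ b = refl

  <ᶠ-↑ʳ : ∀ (y y′ : Fin b) → (a ↑ʳ y) <ᶠ (a ↑ʳ y′) ≡ y <ᶠ y′
  <ᶠ-↑ʳ y y′ rewrite Finₚ.toℕ-↑ʳ {b} a y | Finₚ.toℕ-↑ʳ {b} a y′ = +-<ᵇ a
    where
    +-<ᵇ : ∀ k → (k + toℕ y <ᵇ k + toℕ y′) ≡ (toℕ y <ᵇ toℕ y′)
    +-<ᵇ zero    = refl
    +-<ᵇ (suc k) = +-<ᵇ k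

  edgeParity-⊕ : ∀ w → edgeParity (adj (G ⊕ H)) w ≡
    edgeParity (adj G) (λ x → w (x ↑ˡ b)) xor edgeParity (adj H) (λ y → w (a ↑ʳ y))
  edgeParity-⊕ w = begin
    ∑[ u < a + b ] ∑[ v < a + b ] T u v
      ≡⟨ sum-cong-≗ (λ u → ∑-splitAt a (T u)) ⟩
    ∑[ u < a + b ] (∑[ x′ < a ] T u (x′ ↑ˡ b) xor ∑[ y′ < b ] T u (a ↑ʳ y′))
      ≡⟨ ∑-splitAt a (λ u → ∑[ x′ < a ] T u (x′ ↑ˡ b) xor ∑[ y′ < b ] T u (a ↑ʳ y′)) ⟩
    ∑[ x < a ] (∑[ x′ < a ] T (x ↑ˡ b) (x′ ↑ˡ b) xor ∑[ y′ < b ] T (x ↑ˡ b) (a ↑ʳ y′))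
      xor ∑[ y < b ] (∑[ x′ < a ] T (a ↑ʳ y) (x′ ↑ˡ b) xor ∑[ y′ < b ] T (a ↑ʳ y) (a ↑ʳ y′))
      ≡⟨ cong₂ _xor_
           (sum-cong-≗ λ x → trans (cong₂ _xor_ (sum-cong-≗ (TGG x)) (∑-zero (TGH x))) (xor-identityʳ _))
           (sum-cong-≗ λ y → cong₂ _xor_ (∑-zero (THG y)) (sum-cong-≗ (THH y))) ⟩
    edgeParity (adj G) (λ x → w (x ↑ˡ b)) xor edgeParity (adj H) (λ y → w (a ↑ʳ y)) ∎
    where
    open ≡-Reasoning
    T : Fin (a + b) → Fin (a + b) → Bool
    T u v = (u <ᶠ v) ∧ (w u ∧ (w v ∧ adj (G ⊕ H) u v))
    zero-right : ∀ l s t → l ∧ (s ∧ (t ∧ false)) ≡ false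
    zero-right = solve-∀ GF₂
    TGG : ∀ x x′ → T (x ↑ˡ b) (x′ ↑ˡ b) ≡ (x <ᶠ x′) ∧ (w (x ↑ˡ b) ∧ (w (x′ ↑ˡ b) ∧ adj G x x′))
    TGG x x′ = cong₂ (λ l e → l ∧ (w (x ↑ˡ b) ∧ (w (x′ ↑ˡ b) ∧ e))) (<ᶠ-↑ˡ x x′) (adj-↑ˡ↑ˡ x x′)
    THH : ∀ y y′ → T (a ↑ʳ y) (a ↑ʳ y′) ≡ (y <ᶠ y′) ∧ (w (a ↑ʳ y) ∧ (w (a ↑ʳ y′) ∧ adj H y y′))
    THH y y′ = cong₂ (λ l e → l ∧ (w (a ↑ʳ y) ∧ (w (a ↑ʳ y′) ∧ e))) (<ᶠ-↑ʳ y y′) (adj-↑ʳ↑ʳ y y′)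
    TGH : ∀ x y′ → T (x ↑ˡ b) (a ↑ʳ y′) ≡ false
    TGH x y′ rewrite adj-↑ˡ↑ʳ x y′ = zero-right ((x ↑ˡ b) <ᶠ (a ↑ʳ y′)) (w (x ↑ˡ b)) (w (a ↑ʳ y′))
    THG : ∀ y x′ → T (a ↑ʳ y) (x′ ↑ˡ b) ≡ false
    THG y x′ rewrite adj-↑ʳ↑ˡ y x′ = zero-right ((a ↑ʳ y) <ᶠ (x′ ↑ˡ b)) (w (a ↑ʳ y)) (w (x′ ↑ˡ b))

  edgeParity-↑ˡ : ∀ w → (∀ y → w (a ↑ʳ y) ≡ false) →
    edgeParity (adj (G ⊕ H)) w ≡ edgeParity (adj G) (λ x → w (x ↑ˡ b))
  edgeParity-↑ˡ w wʳ≗0 = begin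
    edgeParity (adj (G ⊕ H)) w
      ≡⟨ edgeParity-⊕ w ⟩
    edgeParity (adj G) (λ x → w (x ↑ˡ b)) xor edgeParity (adj H) (λ y → w (a ↑ʳ y))
      ≡⟨ cong (edgeParity (adj G) (λ x → w (x ↑ˡ b)) xor_)
              (trans (edgeParity-cong {M = adj H} (λ _ _ → refl) wʳ≗0) (edgeParity-zero (adj H))) ⟩
    edgeParity (adj G) (λ x → w (x ↑ˡ b)) xor false
      ≡⟨ xor-identityʳ _ ⟩
    edgeParity (adj G) (λ x → w (x ↑ˡ b)) ∎
    where open ≡-Reasoning

  module _ {ι : Fin a → Maybe (Fin p)} {κ : Fin b → Maybe (Fin q)} {c : Fin (p + q) → Bool}
           (null : Null (G ⊕ H) (extend (ι ⊕ᶜ κ) c)) where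

    Null-↑ˡ : Null G (extend ι (λ j → c (j ↑ˡ q)))
    Null-↑ˡ = Null-resp {G} (extend-↑ˡ ι κ c) λ x → trans (sym (degree-↑ˡ _ x)) (null (x ↑ˡ b))

    Null-↑ʳ : Null H (extend κ (λ j → c (p ↑ʳ j)))
    Null-↑ʳ = Null-resp {H} (extend-↑ʳ ι κ c) λ y → trans (sym (degree-↑ʳ _ y)) (null (a ↑ʳ y))

  NullFree-⊕ : NullFree G p → NullFree H q → NullFree (G ⊕ H) (p + q)
  NullFree-⊕ (ι , avoidsG) (κ , avoidsH) = ι ⊕ᶜ κ , λ c null →
    ↑-elim (avoidsG (λ j → c (j ↑ˡ _)) (Null-↑ˡ {ι = ι} {κ} {c} null))
           (avoidsH (λ j → c (_ ↑ʳ j)) (Null-↑ʳ {ι = ι} {κ} {c} null))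

  EvenNullFree-⊕ : EvenNullFree G p → NullFree H q → EvenNullFree (G ⊕ H) (p + q)
  EvenNullFree-⊕ {p} {q} (ι , avoidsG) (κ , avoidsH) = ι ⊕ᶜ κ , avoids
    where
    avoids : Avoids (EvenNull (G ⊕ H)) (ι ⊕ᶜ κ)
    avoids c (null , even) = ↑-elim (avoidsG (λ j → c (j ↑ˡ q)) (Null-↑ˡ {ι = ι} {κ} {c} null , evenˡ)) cʳ≗0
      where
      cʳ≗0 : ∀ j → c (p ↑ʳ j) ≡ false
      cʳ≗0 = avoidsH (λ j → c (p ↑ʳ j)) (Null-↑ʳ {ι = ι} {κ} {c} null)
      evenˡ : edgeParity (adj G) (extend ι (λ j → c (j ↑ˡ q))) ≡ false
      evenˡ = trans (edgeParity-cong {M = adj G} (λ _ _ → refl) (sym ∘ extend-↑ˡ ι κ c))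
                    (trans (sym (edgeParity-↑ˡ (extend (ι ⊕ᶜ κ) c) λ y → trans (extend-↑ʳ ι κ c y) (extend-zero κ cʳ≗0 y)))
                           even)

∅² : Biclique n
∅² = (λ _ → false) , (λ _ → false)

module _ {a b : ℕ} where

  glue : Biclique a × Biclique b → Biclique (a + b)
  glue ((X , Y) , (X′ , Y′)) = X V.++ X′ , Y V.++ Y′

  cross : Biclique a × Biclique b → Fin a → Fin b → Bool
  cross ((X , Y) , (X′ , Y′)) x y = (X x ∧ Y′ y) xor (X′ y ∧ Y x)

  glue-disjoint : ∀ {s} → Disjoint (proj₁ s) → Disjoint (proj₂ s) → Disjoint (glue s)
  glue-disjoint {(X , Y) , (X′ , Y′)} disj disj′ =
    ↑-elim (λ x → subst (λ z → [ X , X′ ]′ z ∧ [ Y , Y′ ]′ z ≡ false) (sym (Finₚ.splitAt-↑ˡ a x b)) (disj x))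
           (λ y → subst (λ z → [ X , X′ ]′ z ∧ [ Y , Y′ ]′ z ≡ false) (sym (Finₚ.splitAt-↑ʳ a b y)) (disj′ y))

  ⟦glue⟧-↑ˡ↑ˡ : ∀ s x x′ → ⟦ glue s ⟧ (x ↑ˡ b) (x′ ↑ˡ b) ≡ ⟦ proj₁ s ⟧ x x′
  ⟦glue⟧-↑ˡ↑ˡ _ x x′ rewrite Finₚ.splitAt-↑ˡ a x b | Finₚ.splitAt-↑ˡ a x′ b = refl

  ⟦glue⟧-↑ʳ↑ʳ : ∀ s y y′ → ⟦ glue s ⟧ (a ↑ʳ y) (a ↑ʳ y′) ≡ ⟦ proj₂ s ⟧ y y′
  ⟦glue⟧-↑ʳ↑ʳ _ y y′ rewrite Finₚ.splitAt-↑ʳ a b y | Finₚ.splitAt-↑ʳ a b y′ = refl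

  ⟦glue⟧-↑ˡ↑ʳ : ∀ s x y → ⟦ glue s ⟧ (x ↑ˡ b) (a ↑ʳ y) ≡ cross s x y
  ⟦glue⟧-↑ˡ↑ʳ _ x y rewrite Finₚ.splitAt-↑ˡ a x b | Finₚ.splitAt-↑ʳ a b y = refl

  ⟦glue⟧-↑ʳ↑ˡ : ∀ s y x → ⟦ glue s ⟧ (a ↑ʳ y) (x ↑ˡ b) ≡ cross s x y
  ⟦glue⟧-↑ʳ↑ˡ ((X , Y) , (X′ , Y′)) y x rewrite Finₚ.splitAt-↑ˡ a x b | Finₚ.splitAt-↑ʳ a b y =
    xor-comm (X′ y ∧ Y x) (X x ∧ Y′ y)

glue-represents : ∀ {G H} (S : List (Biclique (size G) × Biclique (size H))) →
  (∀ x x′ → ¬ x ≡ x′ → ∑[ s ∈ S ] ⟦ proj₁ s ⟧ x x′ ≡ adj G x x′) →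
  (∀ y y′ → ¬ y ≡ y′ → ∑[ s ∈ S ] ⟦ proj₂ s ⟧ y y′ ≡ adj H y y′) →
  (∀ x y → ∑[ s ∈ S ] cross s x y ≡ false) →
  Represents (G ⊕ H) (map glue S)
glue-represents {G} {H} S repG repH cross≡0 u v u≢v =
  trans (∑ˡ-map glue S (λ B → ⟦ B ⟧ u v))
        (↑-elim {P = λ u → ∀ v → ¬ u ≡ v → ∑[ s ∈ S ] ⟦ glue s ⟧ u v ≡ adj (G ⊕ H) u v}
    (λ x → ↑-elim
      (λ x′ x≢x′ → trans (∑ˡ-cong S (λ s → ⟦glue⟧-↑ˡ↑ˡ s x x′))
                          (trans (repG x x′ (x≢x′ ∘ cong (_↑ˡ size H))) (sym (adj-↑ˡ↑ˡ G H x x′))))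
      (λ y _ → trans (∑ˡ-cong S (λ s → ⟦glue⟧-↑ˡ↑ʳ s x y)) (trans (cross≡0 x y) (sym (adj-↑ˡ↑ʳ G H x y)))))
    (λ y → ↑-elim
      (λ x _ → trans (∑ˡ-cong S (λ s → ⟦glue⟧-↑ʳ↑ˡ s y x)) (trans (cross≡0 x y) (sym (adj-↑ʳ↑ˡ G H y x))))
      (λ y′ y≢y′ → trans (∑ˡ-cong S (λ s → ⟦glue⟧-↑ʳ↑ʳ s y y′))
                          (trans (repH y y′ (y≢y′ ∘ cong (size G ↑ʳ_))) (sym (adj-↑ʳ↑ʳ G H y y′)))))
    u v u≢v)

OddCover-⊕ : ∀ {G H k l} → OddCover G k → OddCover H l → OddCover (G ⊕ H) (k + l)
OddCover-⊕ {G} {H} {k} {l} 𝒞 𝒟 = record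
  { bicliques  = map glue S
  ; disjoint   = All.map⁺ (All.++⁺ (All.map⁺ (All.map (λ d → glue-disjoint d (λ _ → refl)) (disjoint 𝒞)))
                                   (All.map⁺ (All.map (λ d → glue-disjoint (λ _ → refl) d) (disjoint 𝒟))))
  ; represents = glue-represents S repG repH cross≡0
  ; length≡    = trans (LP.length-map glue S)
                       (trans (LP.length-++ (map inˡ Bs))
                              (cong₂ _+_ (trans (LP.length-map inˡ Bs) (length≡ 𝒞))
                                         (trans (LP.length-map inʳ Cs) (length≡ 𝒟))))
  }
  where
  open OddCover
  Bs : List (Biclique (size G))
  Bs = bicliques 𝒞
  Cs : List (Biclique (size H))
  Cs = bicliques 𝒟
  inˡ : Biclique (size G) → Biclique (size G) × Biclique (size H)
  inˡ B = B , ∅²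
  inʳ : Biclique (size H) → Biclique (size G) × Biclique (size H)
  inʳ C = ∅² , C
  S : List (Biclique (size G) × Biclique (size H))
  S = map inˡ Bs ++ map inʳ Cs
  sides-∑ : (f : Biclique (size G) × Biclique (size H) → Bool) →
    ∑[ s ∈ S ] f s ≡ ∑[ B ∈ Bs ] f (inˡ B) xor ∑[ C ∈ Cs ] f (inʳ C)
  sides-∑ f = trans (∑ˡ-++ (map inˡ Bs) (map inʳ Cs) f) (cong₂ _xor_ (∑ˡ-map inˡ Bs f) (∑ˡ-map inʳ Cs f))
  repG : ∀ x x′ → ¬ x ≡ x′ → ∑[ s ∈ S ] ⟦ proj₁ s ⟧ x x′ ≡ adj G x x′
  repG x x′ x≢x′ = trans (sides-∑ (λ s → ⟦ proj₁ s ⟧ x x′))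
    (trans (cong (form Bs x x′ xor_) (∑ˡ-zero Cs (λ _ → refl))) (trans (xor-identityʳ _) (represents 𝒞 x x′ x≢x′)))
  repH : ∀ y y′ → ¬ y ≡ y′ → ∑[ s ∈ S ] ⟦ proj₂ s ⟧ y y′ ≡ adj H y y′
  repH y y′ y≢y′ = trans (sides-∑ (λ s → ⟦ proj₂ s ⟧ y y′))
    (trans (cong (_xor form Cs y y′) (∑ˡ-zero Bs (λ _ → refl))) (represents 𝒟 y y′ y≢y′))
  cross≡0 : ∀ x y → ∑[ s ∈ S ] cross s x y ≡ false
  cross≡0 x y = trans (sides-∑ (λ s → cross s x y))
    (cong₂ _xor_ (∑ˡ-zero Bs (λ B → trans (xor-identityʳ _) (∧-zeroʳ (proj₁ B x))))
                 (∑ˡ-zero Cs (λ C → ∧-zeroʳ (proj₁ C y))))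

record BalancedCover (G : Graph) (k : ℕ) : Set where
  field
    P Q         : Subset (size G)
    Rs Os       : List (Biclique (size G))
    PQ-disjoint : Disjoint (P , Q)
    Rs-disjoint : All Disjoint Rs
    Os-disjoint : All Disjoint Os
    represents  : Represents G ((P , Q) ∷ Rs ++ Os)
    balanced    : ∀ v → P v xor ∑[ B ∈ Rs ] proj₂ B v ≡ Q v
    length≡     : suc (length Rs + length Os) ≡ k

BalancedCover⇒OddCover : ∀ {G k} → BalancedCover G k → OddCover G k
BalancedCover⇒OddCover ℬ = record
  { bicliques  = (P , Q) ∷ Rs ++ Os
  ; disjoint   = PQ-disjoint ∷ All.++⁺ Rs-disjoint Os-disjoint
  ; represents = represents
  ; length≡    = trans (cong suc (LP.length-++ Rs)) length≡
  }
  where open BalancedCover ℬ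

OddCover⇒BalancedCover : ∀ {G k} → OddCover G k → BalancedCover G (suc k)
OddCover⇒BalancedCover 𝒞 = record
  { P = λ _ → false ; Q = λ _ → false ; Rs = [] ; Os = bicliques
  ; PQ-disjoint = λ _ → refl ; Rs-disjoint = [] ; Os-disjoint = disjoint
  ; represents = represents ; balanced = λ _ → refl ; length≡ = cong suc length≡
  }
  where open OddCover 𝒞

-- Paths and cycles

≡ᵇ-sym : ∀ i j → (i ≡ᵇ j) ≡ (j ≡ᵇ i)
≡ᵇ-sym zero    zero    = refl
≡ᵇ-sym zero    (suc j) = refl
≡ᵇ-sym (suc i) zero    = refl
≡ᵇ-sym (suc i) (suc j) = ≡ᵇ-sym i j

≢⇒≡ᵇ-false : ∀ {i j} → ¬ i ≡ j → (i ≡ᵇ j) ≡ false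
≢⇒≡ᵇ-false {i} {j} i≢j with i ≡ᵇ j in eq
... | true  = ⊥-elim (i≢j (ℕₚ.≡ᵇ⇒≡ i j (subst 𝔹.T (sym eq) tt)))
... | false = refl

≡ᵇ-∧-subst : ∀ i j (f : ℕ → Bool) → (i ≡ᵇ j) ∧ f i ≡ (i ≡ᵇ j) ∧ f j
≡ᵇ-∧-subst i j f with i ≡ᵇ j in eq
... | true  = cong f (ℕₚ.≡ᵇ⇒≡ i j (subst 𝔹.T (sym eq) tt))
... | false = refl

≡ᵇ-distinct : ∀ {a b} → ¬ a ≡ b → ∀ i → (i ≡ᵇ a) ∧ (i ≡ᵇ b) ≡ false
≡ᵇ-distinct {a} {b} a≢b i =
  trans (≡ᵇ-∧-subst i a (_≡ᵇ b)) (trans (cong ((i ≡ᵇ a) ∧_) (≢⇒≡ᵇ-false a≢b)) (∧-zeroʳ (i ≡ᵇ a)))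

<ᵇ-suc : ∀ i j → (i <ᵇ suc j) ≡ (i <ᵇ j) xor (i ≡ᵇ j)
<ᵇ-suc zero    zero    = refl
<ᵇ-suc zero    (suc j) = refl
<ᵇ-suc (suc i) zero    = refl
<ᵇ-suc (suc i) (suc j) = <ᵇ-suc i j

δ : ℕ → Subset n
δ i v = toℕ v ≡ᵇ i

at : Subset n → ℕ → Bool
at w i = δ i · w

at-toℕ : (w : Subset n) (v : Fin n) → at w (toℕ v) ≡ w v
at-toℕ w v = ∑-point w v

degree-pair : (M : Matrix n) (w : Subset n) {x : Fin n} {i j : ℕ} → (∀ v → M v x ≡ δ i v xor δ j v) →
  degree M w x ≡ at w i xor at w j
degree-pair M w {x} {i} {j} M·x≡δ⊕δ =
  trans (sum-cong-≗ λ v → trans (cong (w v ∧_) (M·x≡δ⊕δ v)) (distrib (w v) (δ i v) (δ j v)))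
        (∑-distrib-+ (λ v → δ i v ∧ w v) (λ v → δ j v ∧ w v))
  where
  distrib : ∀ w a b → w ∧ (a xor b) ≡ (a ∧ w) xor (b ∧ w)
  distrib = solve-∀ GF₂

edge : ℕ → ℕ → Matrix n
edge i j = δ i ⊗ δ j

edgeParity-edge : ∀ {i j} → ¬ i ≡ j → (w : Subset n) → edgeParity (edge i j) w ≡ at w i ∧ at w j
edgeParity-edge {i = i} {j} i≢j = edgeParity-⊗ (δ i) (δ j) (≡ᵇ-distinct i≢j ∘ toℕ)

path : ℕ → Matrix n
path zero    u v = false
path (suc i) u v = path i u v xor edge i (suc i) u v

path-≡ᵇ : ∀ i (u v : Fin n) →
  path i u v ≡ ((toℕ u <ᵇ i) ∧ (toℕ v ≡ᵇ suc (toℕ u))) xor ((toℕ v <ᵇ i) ∧ (toℕ u ≡ᵇ suc (toℕ v)))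
path-≡ᵇ zero    u v = refl
path-≡ᵇ (suc i) u v = begin
  path i u v xor edge i (suc i) u v
    ≡⟨ cong (_xor edge i (suc i) u v) (path-≡ᵇ i u v) ⟩
  (((s <ᵇ i) ∧ (t ≡ᵇ suc s)) xor ((t <ᵇ i) ∧ (s ≡ᵇ suc t))) xor (((s ≡ᵇ i) ∧ (t ≡ᵇ suc i)) xor ((t ≡ᵇ i) ∧ (s ≡ᵇ suc i)))
    ≡⟨ cong₂ (λ e e′ → (((s <ᵇ i) ∧ (t ≡ᵇ suc s)) xor ((t <ᵇ i) ∧ (s ≡ᵇ suc t))) xor (e xor e′))
             (sym (≡ᵇ-∧-subst s i (λ a → t ≡ᵇ suc a))) (sym (≡ᵇ-∧-subst t i (λ a → s ≡ᵇ suc a))) ⟩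
  (((s <ᵇ i) ∧ (t ≡ᵇ suc s)) xor ((t <ᵇ i) ∧ (s ≡ᵇ suc t))) xor (((s ≡ᵇ i) ∧ (t ≡ᵇ suc s)) xor ((t ≡ᵇ i) ∧ (s ≡ᵇ suc t)))
    ≡⟨ regroup (s <ᵇ i) (s ≡ᵇ i) (t ≡ᵇ suc s) (t <ᵇ i) (t ≡ᵇ i) (s ≡ᵇ suc t) ⟩
  (((s <ᵇ i) xor (s ≡ᵇ i)) ∧ (t ≡ᵇ suc s)) xor (((t <ᵇ i) xor (t ≡ᵇ i)) ∧ (s ≡ᵇ suc t))
    ≡⟨ sym (cong₂ (λ l l′ → (l ∧ (t ≡ᵇ suc s)) xor (l′ ∧ (s ≡ᵇ suc t))) (<ᵇ-suc s i) (<ᵇ-suc t i)) ⟩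
  ((s <ᵇ suc i) ∧ (t ≡ᵇ suc s)) xor ((t <ᵇ suc i) ∧ (s ≡ᵇ suc t)) ∎
  where
  open ≡-Reasoning
  s t : ℕ
  s = toℕ u
  t = toℕ v
  regroup : ∀ l e a l′ e′ a′ → ((l ∧ a) xor (l′ ∧ a′)) xor ((e ∧ a) xor (e′ ∧ a′))
                                ≡ ((l xor e) ∧ a) xor ((l′ xor e′) ∧ a′)
  regroup = solve-∀ GF₂

<⇒<ᵇ≡true : ∀ {i j} → i < j → (i <ᵇ j) ≡ true
<⇒<ᵇ≡true {i} {j} i<j with i <ᵇ j | ℕₚ.<⇒<ᵇ i<j
... | true | _ = refl

ss<⇒< : ∀ {i} → suc (suc i) < n → i < n
ss<⇒< {i = i} ssi<n = ℕₚ.<-trans (ℕₚ.n<1+n i) (ℕₚ.<-trans (ℕₚ.n<1+n (suc i)) ssi<n)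

module Cycle (k : ℕ) where

  K : ℕ
  K = suc (suc k)

  r : ℕ
  r = suc K

  cycleAdj-≡ᵇ : ∀ u v → cycleAdj r u v ≡
    (toℕ v ≡ᵇ suc (toℕ u)) ∨ ((toℕ u ≡ᵇ suc (toℕ v))
      ∨ (((toℕ u ≡ᵇ 0) ∧ (toℕ v ≡ᵇ K)) ∨ ((toℕ v ≡ᵇ 0) ∧ (toℕ u ≡ᵇ K))))
  cycleAdj-≡ᵇ u v
    rewrite isYes≗does (toℕ v ℕ.≟ suc (toℕ u)) | isYes≗does (toℕ u ℕ.≟ suc (toℕ v))
          | isYes≗does (toℕ u ℕ.≟ 0) | isYes≗does (toℕ v ℕ.≟ K)
          | isYes≗does (toℕ v ℕ.≟ 0) | isYes≗does (toℕ u ℕ.≟ K) = refl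

  irreflexive : Irreflexive (C r)
  irreflexive u rewrite cycleAdj-≡ᵇ u u = no-loop (toℕ u)
    where
    no-loop : ∀ i →
      (i ≡ᵇ suc i) ∨ ((i ≡ᵇ suc i) ∨ (((i ≡ᵇ 0) ∧ (i ≡ᵇ K)) ∨ ((i ≡ᵇ 0) ∧ (i ≡ᵇ K)))) ≡ false
    no-loop zero    = refl
    no-loop (suc i) rewrite ≢⇒≡ᵇ-false {i} {suc i} (ℕₚ.1+n≢n ∘ sym) = refl

  neighbours-suc : ∀ {i} → suc (suc i) < r → ∀ v x → toℕ x ≡ suc i → cycleAdj r v x ≡ δ i v xor δ (suc (suc i)) v
  neighbours-suc {i} ssi<r v x x≡si
    rewrite cycleAdj-≡ᵇ v x | x≡si | ≢⇒≡ᵇ-false (ℕₚ.<⇒≢ (ℕₚ.≤-pred (ℕₚ.≤-pred ssi<r)))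
          | ∧-zeroʳ (toℕ v ≡ᵇ 0) | ∨-identityʳ (toℕ v ≡ᵇ suc (suc i)) | ≡ᵇ-sym i (toℕ v)
    = ∨≡xor {toℕ v ≡ᵇ i} {toℕ v ≡ᵇ suc (suc i)}
            (≡ᵇ-distinct (ℕₚ.<⇒≢ (ℕₚ.m≤n⇒m≤1+n (ℕₚ.n<1+n i))) (toℕ v))

  neighbours-zero : ∀ v → cycleAdj r v zero ≡ δ 1 v xor δ K v
  neighbours-zero v rewrite cycleAdj-≡ᵇ v zero | ∧-zeroʳ (toℕ v ≡ᵇ 0) =
    ∨≡xor {toℕ v ≡ᵇ 1} {toℕ v ≡ᵇ K} (≡ᵇ-distinct (λ ()) (toℕ v))

  module _ (w : Subset r) (null : Null (C r) w) where

    Null-step : ∀ i → suc (suc i) < r → at w i ≡ at w (suc (suc i))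
    Null-step i ssi<r =
      xor≡false⇒≡ (trans (sym (degree-pair (adj (C r)) w {x} {i} {suc (suc i)} (λ v → neighbours-suc ssi<r v x x≡si)))
                         (null x))
      where
      si<r : suc i < r
      si<r = ℕₚ.<-trans (ℕₚ.n<1+n (suc i)) ssi<r
      x : Fin r
      x = Fin.fromℕ< si<r
      x≡si : toℕ x ≡ suc i
      x≡si = Finₚ.toℕ-fromℕ< si<r

    Null-wrap : at w 1 ≡ at w K
    Null-wrap = xor≡false⇒≡ (trans (sym (degree-pair (adj (C r)) w {zero} {1} {K} neighbours-zero)) (null zero))

    Null-two-valued : ∀ i → i < r → at w i ≡ at w 0 ⊎ at w i ≡ at w 1
    Null-two-valued zero          _     = inj₁ refl
    Null-two-valued (suc zero)    _     = inj₂ refl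
    Null-two-valued (suc (suc i)) ssi<r =
      Sum.map (trans (sym (Null-step i ssi<r))) (trans (sym (Null-step i ssi<r)))
              (Null-two-valued i (ss<⇒< ssi<r))

    Null-even : ∀ j → 2 * j < r → at w (2 * j) ≡ at w 0
    Null-even zero    _      = refl
    Null-even (suc j) 2j+2<r = begin
      at w (2 * suc j)      ≡⟨ cong (at w) (ℕₚ.*-suc 2 j) ⟩
      at w (2 + 2 * j)      ≡⟨ sym (Null-step (2 * j) (subst (_< r) (ℕₚ.*-suc 2 j) 2j+2<r)) ⟩
      at w (2 * j)          ≡⟨ Null-even j (ss<⇒< (subst (_< r) (ℕₚ.*-suc 2 j) 2j+2<r)) ⟩
      at w 0                ∎
      where open ≡-Reasoning

  adj≡path⊕edge : ∀ u v → cycleAdj r u v ≡ path K u v xor edge 0 K u v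
  adj≡path⊕edge u v =
    trans (cycleAdj-≡ᵇ u v) (trans (cycle (toℕ u) (toℕ v) (Finₚ.toℕ<n u) (Finₚ.toℕ<n v))
                                   (cong (_xor edge 0 K u v) (sym (path-≡ᵇ K u v))))
    where
    bounded : ∀ {t} a → t < K → (a <ᵇ K) ∧ (t ≡ᵇ a) ≡ (t ≡ᵇ a)
    bounded {t} a t<K = begin
      (a <ᵇ K) ∧ (t ≡ᵇ a)   ≡⟨ ∧-comm (a <ᵇ K) (t ≡ᵇ a) ⟩
      (t ≡ᵇ a) ∧ (a <ᵇ K)   ≡⟨ sym (≡ᵇ-∧-subst t a (_<ᵇ K)) ⟩
      (t ≡ᵇ a) ∧ (t <ᵇ K)   ≡⟨ cong ((t ≡ᵇ a) ∧_) (<⇒<ᵇ≡true t<K) ⟩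
      (t ≡ᵇ a) ∧ true       ≡⟨ ∧-identityʳ (t ≡ᵇ a) ⟩
      (t ≡ᵇ a)              ∎
      where open ≡-Reasoning
    suc-exclusive : ∀ s t → (t ≡ᵇ suc s) ∧ (s ≡ᵇ suc t) ≡ false
    suc-exclusive s t = trans (≡ᵇ-∧-subst t (suc s) (λ a → s ≡ᵇ suc a))
      (trans (cong ((t ≡ᵇ suc s) ∧_) (≢⇒≡ᵇ-false (ℕₚ.<⇒≢ (ℕₚ.m≤n⇒m≤1+n (ℕₚ.n<1+n s))))) (∧-zeroʳ _))
    cycle : ∀ s t → s < r → t < r →
      (t ≡ᵇ suc s) ∨ ((s ≡ᵇ suc t) ∨ (((s ≡ᵇ 0) ∧ (t ≡ᵇ K)) ∨ ((t ≡ᵇ 0) ∧ (s ≡ᵇ K))))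
        ≡ (((s <ᵇ K) ∧ (t ≡ᵇ suc s)) xor ((t <ᵇ K) ∧ (s ≡ᵇ suc t))) xor (((s ≡ᵇ 0) ∧ (t ≡ᵇ K)) xor ((t ≡ᵇ 0) ∧ (s ≡ᵇ K)))
    cycle zero          zero          _ _ = refl
    cycle zero          (suc zero)    _ _ = refl
    cycle zero          (suc (suc t)) _ _
      rewrite ∧-zeroʳ (t <ᵇ k) | ∨-identityʳ (t ≡ᵇ k) | xor-identityʳ (t ≡ᵇ k) = refl
    cycle (suc zero)    zero          _ _ = refl
    cycle (suc (suc s)) zero          _ _ rewrite ∧-zeroʳ (s <ᵇ k) = refl
    cycle (suc s)       (suc t)       s<r t<r = begin
      (t ≡ᵇ suc s) ∨ ((s ≡ᵇ suc t) ∨ false)    ≡⟨ cong ((t ≡ᵇ suc s) ∨_) (∨-identityʳ (s ≡ᵇ suc t)) ⟩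
      (t ≡ᵇ suc s) ∨ (s ≡ᵇ suc t)              ≡⟨ ∨≡xor {t ≡ᵇ suc s} {s ≡ᵇ suc t} (suc-exclusive s t) ⟩
      (t ≡ᵇ suc s) xor (s ≡ᵇ suc t)
        ≡⟨ sym (cong₂ _xor_ (bounded (suc s) (ℕₚ.≤-pred t<r)) (bounded (suc t) (ℕₚ.≤-pred s<r))) ⟩
      ((suc s <ᵇ K) ∧ (t ≡ᵇ suc s)) xor ((suc t <ᵇ K) ∧ (s ≡ᵇ suc t))
                                               ≡⟨ sym (xor-identityʳ _) ⟩
      (((suc s <ᵇ K) ∧ (t ≡ᵇ suc s)) xor ((suc t <ᵇ K) ∧ (s ≡ᵇ suc t))) xor false ∎
      where open ≡-Reasoning

δ₂ : ℕ → ℕ → Subset n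
δ₂ i j v = δ i v xor δ j v

δ₂-disjoint : ∀ {a b c d} → ¬ a ≡ c → ¬ a ≡ d → ¬ b ≡ c → ¬ b ≡ d → Disjoint (δ₂ {n} a b , δ₂ c d)
δ₂-disjoint {a = a} {b} {c} {d} a≢c a≢d b≢c b≢d v = begin
  (δ a v xor δ b v) ∧ (δ c v xor δ d v)
    ≡⟨ expand (δ a v) (δ b v) (δ c v) (δ d v) ⟩
  ((δ a v ∧ δ c v) xor (δ a v ∧ δ d v)) xor ((δ b v ∧ δ c v) xor (δ b v ∧ δ d v))
    ≡⟨ cong₂ _xor_ (cong₂ _xor_ (≡ᵇ-distinct a≢c (toℕ v)) (≡ᵇ-distinct a≢d (toℕ v)))
                   (cong₂ _xor_ (≡ᵇ-distinct b≢c (toℕ v)) (≡ᵇ-distinct b≢d (toℕ v))) ⟩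
  false ∎
  where
  open ≡-Reasoning
  expand : ∀ a b c d → (a xor b) ∧ (c xor d) ≡ ((a ∧ c) xor (a ∧ d)) xor ((b ∧ c) xor (b ∧ d))
  expand = solve-∀ GF₂

rung : ℕ → Biclique n
rung d = δ₂ 0 (2 + d) , δ₂ (1 + d) (3 + d)

rung-disjoint : ∀ d → Disjoint (rung {n} d)
rung-disjoint d = δ₂-disjoint (λ ()) (λ ()) ℕₚ.1+n≢n (ℕₚ.1+n≢n ∘ sym)

rungs : ℕ → List (Biclique n)
rungs zero    = []
rungs (suc j) = rung (2 * j) ∷ rungs j

rungs-disjoint : ∀ j → All Disjoint (rungs {n} j)
rungs-disjoint zero    = []
rungs-disjoint (suc j) = rung-disjoint (2 * j) ∷ rungs-disjoint j

length-rungs : ∀ j → length (rungs {n} j) ≡ j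
length-rungs zero    = refl
length-rungs (suc j) = cong suc (length-rungs j)

form-rungs : ∀ j (u v : Fin n) → form (rungs j) u v ≡ path (suc (2 * j)) u v xor edge 0 (suc (2 * j)) u v
form-rungs zero    u v = sym (xor-same (edge 0 1 u v))
form-rungs (suc j) u v = begin
  ⟦ rung d ⟧ u v xor form (rungs j) u v
    ≡⟨ cong (⟦ rung d ⟧ u v xor_) (form-rungs j u v) ⟩
  ⟦ rung d ⟧ u v xor (path (1 + d) u v xor edge 0 (1 + d) u v)
    ≡⟨ telescope (path (1 + d) u v) (δ 0 u) (δ 0 v) (δ (1 + d) u) (δ (1 + d) v)
                 (δ (2 + d) u) (δ (2 + d) v) (δ (3 + d) u) (δ (3 + d) v) ⟩
  path (3 + d) u v xor edge 0 (3 + d) u v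
    ≡⟨ cong (λ i → path (suc i) u v xor edge 0 (suc i) u v) (sym (ℕₚ.*-suc 2 j)) ⟩
  path (suc (2 * suc j)) u v xor edge 0 (suc (2 * suc j)) u v ∎
  where
  open ≡-Reasoning
  d : ℕ
  d = 2 * j
  telescope : ∀ P z z′ a a′ b b′ c c′ →
    (((z xor b) ∧ (a′ xor c′)) xor ((z′ xor b′) ∧ (a xor c))) xor (P xor ((z ∧ a′) xor (z′ ∧ a)))
      ≡ ((P xor ((a ∧ b′) xor (a′ ∧ b))) xor ((b ∧ c′) xor (b′ ∧ c))) xor ((z ∧ c′) xor (z′ ∧ c))
  telescope = solve-∀ GF₂

skip : (s : ℕ) → Fin (s + p) → Maybe (Fin p)
skip zero    v       = just v
skip (suc s) zero    = nothing
skip (suc s) (suc v) = skip s v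

ones : ∀ n → Subset n
ones _ _ = true

at-ones : ∀ {i} → i < n → at (ones n) i ≡ true
at-ones {n} i<n = trans (cong (at (ones n)) (sym (Finₚ.toℕ-fromℕ< i<n))) (at-toℕ (ones n) (Fin.fromℕ< i<n))

edgeParity-path-ones : ∀ j → 2 * j < n → edgeParity (path {n} (2 * j)) (ones n) ≡ false
edgeParity-path-ones {n} zero    _      =
  ∑-zero {f = λ u → ∑[ v < n ] ((u <ᶠ v) ∧ false)} λ u → ∑-zero λ v → ∧-zeroʳ (u <ᶠ v)
edgeParity-path-ones {n} (suc j) 2j+2<n = begin
  edgeParity (path (2 * suc j)) (ones n)
    ≡⟨ cong (λ i → edgeParity (path i) (ones n)) (ℕₚ.*-suc 2 j) ⟩
  edgeParity (path (2 + 2 * j)) (ones n)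
    ≡⟨ edgeParity-xor (path (1 + 2 * j)) (edge (1 + 2 * j) (2 + 2 * j)) (ones n) ⟩
  edgeParity (path (1 + 2 * j)) (ones n) xor edgeParity (edge (1 + 2 * j) (2 + 2 * j)) (ones n)
    ≡⟨ cong (_xor edgeParity (edge (1 + 2 * j) (2 + 2 * j)) (ones n))
            (edgeParity-xor (path (2 * j)) (edge (2 * j) (1 + 2 * j)) (ones n)) ⟩
  (edgeParity (path (2 * j)) (ones n) xor edgeParity (edge (2 * j) (1 + 2 * j)) (ones n))
    xor edgeParity (edge (1 + 2 * j) (2 + 2 * j)) (ones n)
    ≡⟨ cong₂ (λ a b → (a xor b) xor edgeParity (edge (1 + 2 * j) (2 + 2 * j)) (ones n))
             (edgeParity-path-ones j (ss<⇒< 2+2j<n)) (edge-ones (2 * j) (ss<⇒< 2+2j<n) (ℕₚ.<-trans (ℕₚ.n<1+n _) 2+2j<n)) ⟩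
  (false xor true) xor edgeParity (edge (1 + 2 * j) (2 + 2 * j)) (ones n)
    ≡⟨ cong ((false xor true) xor_) (edge-ones (1 + 2 * j) (ℕₚ.<-trans (ℕₚ.n<1+n _) 2+2j<n) 2+2j<n) ⟩
  false ∎
  where
  open ≡-Reasoning
  2+2j<n : 2 + 2 * j < n
  2+2j<n = subst (_< n) (ℕₚ.*-suc 2 j) 2j+2<n
  edge-ones : ∀ i → i < n → suc i < n → edgeParity (edge i (suc i)) (ones n) ≡ true
  edge-ones i i<n si<n = trans (edgeParity-edge (ℕₚ.1+n≢n ∘ sym) (ones n)) (cong₂ _∧_ (at-ones i<n) (at-ones si<n))

module OddCycle (n′ : ℕ) where
  open Cycle (2 * n′) public

  Null-constant : ∀ w → Null (C r) w → ∀ v → w v ≡ w zero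
  Null-constant w null v with Null-two-valued w null (toℕ v) (Finₚ.toℕ<n v)
  ... | inj₁ wv≡w0 = trans (sym (at-toℕ w v)) (trans wv≡w0 (at-toℕ w zero))
  ... | inj₂ wv≡w1 = trans (sym (at-toℕ w v)) (trans wv≡w1 (trans w1≡w0 (at-toℕ w zero)))
    where
    w1≡w0 : at w 1 ≡ at w 0
    w1≡w0 = trans (Null-wrap w null) (trans (cong (at w) (sym (ℕₚ.*-suc 2 n′)))
                                          (Null-even w null (suc n′) (subst (_< r) (sym (ℕₚ.*-suc 2 n′)) (ℕₚ.n<1+n K))))

  edgeParity-ones : edgeParity (adj (C r)) (ones r) ≡ true
  edgeParity-ones = begin
    edgeParity (adj (C r)) (ones r)
      ≡⟨ edgeParity-cong {M = adj (C r)} {w = ones r} adj≡path⊕edge (λ _ → refl) ⟩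
    edgeParity (λ u v → path K u v xor edge 0 K u v) (ones r)
      ≡⟨ edgeParity-xor (path K) (edge 0 K) (ones r) ⟩
    edgeParity (path K) (ones r) xor edgeParity (edge 0 K) (ones r)
      ≡⟨ cong₂ _xor_ (trans (cong (λ i → edgeParity (path i) (ones r)) (sym (ℕₚ.*-suc 2 n′)))
                            (edgeParity-path-ones (suc n′) (subst (_< r) (sym (ℕₚ.*-suc 2 n′)) (ℕₚ.n<1+n K))))
                     (trans (edgeParity-edge {i = 0} {j = K} (λ ()) (ones r))
                            (cong₂ _∧_ (at-ones {r} (ℕ.s≤s ℕ.z≤n)) (at-ones {r} (ℕₚ.n<1+n K)))) ⟩
    true ∎
    where open ≡-Reasoning

  nullFree : NullFree (C r) K
  nullFree = skip 1 , λ c null j → Null-constant (extend (skip 1) c) null (suc j)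

  evenNullFree : EvenNullFree (C r) r
  evenNullFree = skip 0 , avoids
    where
    avoids : Avoids (EvenNull (C r)) (skip 0)
    avoids c (null , even) j = trans (Null-constant c null j) (¬-not c₀≢true)
      where
      c₀≢true : ¬ c zero ≡ true
      c₀≢true c₀≡true = true≢false (begin
        true                                 ≡⟨ sym edgeParity-ones ⟩
        edgeParity (adj (C r)) (ones r)          ≡⟨ edgeParity-cong {M = adj (C r)} (λ _ _ → refl)
                                                  (λ v → sym (trans (Null-constant c null v) c₀≡true)) ⟩
        edgeParity (adj (C r)) c             ≡⟨ even ⟩
        false                                ∎)
        where
        open ≡-Reasoning
        true≢false : ¬ true ≡ false
        true≢false ()

  J : ℕ
  J = suc (2 * n′)

  cycleAdj≡gadget : ∀ x x′ → adj (C r) x x′ ≡ edge J K x x′ xor ((δ 0 ⊗ δ₂ J K) x x′ xor form (rungs n′) x x′)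
  cycleAdj≡gadget x x′ = begin
    adj (C r) x x′
      ≡⟨ adj≡path⊕edge x x′ ⟩
    (path J x x′ xor edge J K x x′) xor edge 0 K x x′
      ≡⟨ regroup (path J x x′) (δ 0 x) (δ 0 x′) (δ J x) (δ J x′) (δ K x) (δ K x′) ⟩
    edge J K x x′ xor ((δ 0 ⊗ δ₂ J K) x x′ xor (path J x x′ xor edge 0 J x x′))
      ≡⟨ cong (λ e → edge J K x x′ xor ((δ 0 ⊗ δ₂ J K) x x′ xor e)) (sym (form-rungs n′ x x′)) ⟩
    edge J K x x′ xor ((δ 0 ⊗ δ₂ J K) x x′ xor form (rungs n′) x x′) ∎
    where
    open ≡-Reasoning
    regroup : ∀ p z z′ j j′ k k′ →
      (p xor ((j ∧ k′) xor (j′ ∧ k))) xor ((z ∧ k′) xor (z′ ∧ k))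
        ≡ ((j ∧ k′) xor (j′ ∧ k)) xor (((z ∧ (j′ xor k′)) xor (z′ ∧ (j xor k))) xor (p xor ((z ∧ j′) xor (z′ ∧ j))))
    regroup = solve-∀ GF₂

  module _ {G : Graph} {k : ℕ} (ℬ : BalancedCover G k) where
    open BalancedCover ℬ

    private
      b : ℕ
      b = size G

      s₀ s₁ : Biclique r × Biclique b
      s₀ = (δ J , δ K) , (P , Q)
      s₁ = (δ 0 , δ₂ J K) , (Q , λ _ → false)

      attach inʳ : Biclique b → Biclique r × Biclique b
      attach B = (δ K , λ _ → false) , B
      inʳ B = ∅² , B

      inˡ : Biclique r → Biclique r × Biclique b
      inˡ B = B , ∅²

      R′ O′ S : List (Biclique r × Biclique b)
      R′ = s₁ ∷ map attach Rs
      O′ = map inʳ Os ++ map inˡ (rungs n′)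
      S  = s₀ ∷ R′ ++ O′

      ∑-gadget : (f : Biclique r × Biclique b → Bool) → ∑[ s ∈ S ] f s ≡
        f s₀ xor ((f s₁ xor ∑[ B ∈ Rs ] f (attach B)) xor (∑[ B ∈ Os ] f (inʳ B) xor ∑[ B ∈ rungs n′ ] f (inˡ B)))
      ∑-gadget f = cong (f s₀ xor_) (trans (∑ˡ-++ R′ O′ f)
        (cong₂ _xor_ (cong (f s₁ xor_) (∑ˡ-map attach Rs f))
                     (trans (∑ˡ-++ (map inʳ Os) (map inˡ (rungs n′)) f)
                            (cong₂ _xor_ (∑ˡ-map inʳ Os f) (∑ˡ-map inˡ (rungs n′) f)))))

    gadget-represents-cycle : ∀ x x′ → ¬ x ≡ x′ → ∑[ s ∈ S ] ⟦ proj₁ s ⟧ x x′ ≡ adj (C r) x x′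
    gadget-represents-cycle x x′ _ = begin
      ∑[ s ∈ S ] ⟦ proj₁ s ⟧ x x′
        ≡⟨ ∑-gadget (λ s → ⟦ proj₁ s ⟧ x x′) ⟩
      edge J K x x′ xor (((δ 0 ⊗ δ₂ J K) x x′ xor ∑[ B ∈ Rs ] (δ K ⊗ (λ _ → false)) x x′)
                          xor (∑[ B ∈ Os ] false xor ∑[ B ∈ rungs n′ ] ⟦ B ⟧ x x′))
        ≡⟨ cong₂ (λ a c → edge J K x x′ xor (((δ 0 ⊗ δ₂ J K) x x′ xor a) xor (c xor form (rungs n′) x x′)))
                 (∑ˡ-zero Rs (λ _ → ⊗-emptyʳ (δ K) x x′)) (∑ˡ-zero Os (λ _ → refl)) ⟩
      edge J K x x′ xor (((δ 0 ⊗ δ₂ J K) x x′ xor false) xor form (rungs n′) x x′)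
        ≡⟨ cong (λ a → edge J K x x′ xor (a xor form (rungs n′) x x′)) (xor-identityʳ ((δ 0 ⊗ δ₂ J K) x x′)) ⟩
      edge J K x x′ xor ((δ 0 ⊗ δ₂ J K) x x′ xor form (rungs n′) x x′)
        ≡⟨ sym (cycleAdj≡gadget x x′) ⟩
      adj (C r) x x′ ∎
      where open ≡-Reasoning

    gadget-represents-rest : ∀ y y′ → ¬ y ≡ y′ → ∑[ s ∈ S ] ⟦ proj₂ s ⟧ y y′ ≡ adj G y y′
    gadget-represents-rest y y′ y≢y′ = begin
      ∑[ s ∈ S ] ⟦ proj₂ s ⟧ y y′
        ≡⟨ ∑-gadget (λ s → ⟦ proj₂ s ⟧ y y′) ⟩
      (P ⊗ Q) y y′ xor (((Q ⊗ (λ _ → false)) y y′ xor form Rs y y′) xor (form Os y y′ xor ∑[ B ∈ rungs n′ ] false))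
        ≡⟨ cong₂ (λ a c → (P ⊗ Q) y y′ xor ((a xor form Rs y y′) xor (form Os y y′ xor c)))
                 (⊗-emptyʳ Q y y′) (∑ˡ-zero (rungs n′) (λ _ → refl)) ⟩
      (P ⊗ Q) y y′ xor (form Rs y y′ xor (form Os y y′ xor false))
        ≡⟨ cong (λ a → (P ⊗ Q) y y′ xor (form Rs y y′ xor a)) (xor-identityʳ (form Os y y′)) ⟩
      (P ⊗ Q) y y′ xor (form Rs y y′ xor form Os y y′)
        ≡⟨ cong ((P ⊗ Q) y y′ xor_) (sym (∑ˡ-++ Rs Os (λ B → ⟦ B ⟧ y y′))) ⟩
      form ((P , Q) ∷ Rs ++ Os) y y′
        ≡⟨ represents y y′ y≢y′ ⟩
      adj G y y′ ∎
      where open ≡-Reasoning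

    gadget-cross≡false : ∀ x y → ∑[ s ∈ S ] cross s x y ≡ false
    gadget-cross≡false x y = begin
      ∑[ s ∈ S ] cross s x y
        ≡⟨ ∑-gadget (λ s → cross s x y) ⟩
      ((δ J x ∧ Q y) xor (P y ∧ δ K x))
        xor ((((δ 0 x ∧ false) xor (Q y ∧ δ₂ J K x)) xor ∑[ B ∈ Rs ] ((δ K x ∧ proj₂ B y) xor (proj₁ B y ∧ false)))
        xor (∑[ B ∈ Os ] (proj₁ B y ∧ false) xor ∑[ B ∈ rungs n′ ] ((proj₁ B x ∧ false) xor false)))
        ≡⟨ cong₂ (λ a c → ((δ J x ∧ Q y) xor (P y ∧ δ K x)) xor ((((δ 0 x ∧ false) xor (Q y ∧ δ₂ J K x)) xor a) xor c))
                 (trans (∑ˡ-cong Rs (λ B → drop-zero (δ K x) (proj₂ B y) (proj₁ B y)))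
                        (sym (∑ˡ-∧ˡ (δ K x) Rs (λ B → proj₂ B y))))
                 (cong₂ _xor_ (∑ˡ-zero Os (λ B → ∧-zeroʳ (proj₁ B y)))
                              (∑ˡ-zero (rungs n′) (λ B → trans (xor-identityʳ _) (∧-zeroʳ (proj₁ B x))))) ⟩
      ((δ J x ∧ Q y) xor (P y ∧ δ K x))
        xor ((((δ 0 x ∧ false) xor (Q y ∧ δ₂ J K x)) xor (δ K x ∧ Y y)) xor false)
        ≡⟨ cong (λ q → ((δ J x ∧ q) xor (P y ∧ δ K x)) xor ((((δ 0 x ∧ false) xor (q ∧ δ₂ J K x)) xor (δ K x ∧ Y y)) xor false))
                (sym (balanced y)) ⟩
      ((δ J x ∧ (P y xor Y y)) xor (P y ∧ δ K x))
        xor ((((δ 0 x ∧ false) xor ((P y xor Y y) ∧ δ₂ J K x)) xor (δ K x ∧ Y y)) xor false)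
        ≡⟨ cancel (δ J x) (δ K x) (δ 0 x) (P y) (Y y) ⟩
      false ∎
      where
      open ≡-Reasoning
      Y : Subset b
      Y v = ∑[ B ∈ Rs ] proj₂ B v
      drop-zero : ∀ k y x → (k ∧ y) xor (x ∧ false) ≡ k ∧ y
      drop-zero = solve-∀ GF₂
      cancel : ∀ j k z p y →
        ((j ∧ (p xor y)) xor (p ∧ k)) xor ((((z ∧ false) xor ((p xor y) ∧ (j xor k))) xor (k ∧ y)) xor false) ≡ false
      cancel = solve-∀ GF₂

    gadget-balanced : ∀ u → (δ J V.++ P) u xor ∑[ B ∈ map glue R′ ] proj₂ B u ≡ (δ K V.++ Q) u
    gadget-balanced u = trans (cong ((δ J V.++ P) u xor_) (∑ˡ-map glue R′ (λ B → proj₂ B u)))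
                              (↑-elim {P = balanced-at} on-cycle on-rest u)
      where
      balanced-at : Fin (r + b) → Set
      balanced-at u = (δ J V.++ P) u xor ∑[ s ∈ R′ ] proj₂ (glue s) u ≡ (δ K V.++ Q) u
      on-cycle : ∀ x → balanced-at (x ↑ˡ b)
      on-cycle x rewrite Finₚ.splitAt-↑ˡ r x b =
        trans (cong (λ a → δ J x xor (δ₂ J K x xor a)) (trans (∑ˡ-map attach Rs _) (∑ˡ-zero Rs (λ _ → refl))))
              (trans (cong (δ J x xor_) (xor-identityʳ _)) (trans (sym (xor-assoc (δ J x) (δ J x) (δ K x)))
                     (cong (_xor δ K x) (xor-same (δ J x)))))
      on-rest : ∀ y → balanced-at (r ↑ʳ y)
      on-rest y rewrite Finₚ.splitAt-↑ʳ r b y = trans (cong (P y xor_) (∑ˡ-map attach Rs _)) (balanced y)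

    gadget-length : suc (length (map glue R′) + length (map glue O′)) ≡ k + suc n′
    gadget-length = begin
      suc (length (map glue R′) + length (map glue O′))
        ≡⟨ cong₂ (λ a c → suc (a + c))
                 (trans (LP.length-map glue R′) (cong suc (LP.length-map attach Rs)))
                 (trans (LP.length-map glue O′) (trans (LP.length-++ (map inʳ Os))
                        (cong₂ _+_ (LP.length-map inʳ Os) (trans (LP.length-map inˡ (rungs n′)) (length-rungs n′))))) ⟩
      suc (suc (length Rs) + (length Os + n′))
        ≡⟨ rearrange (length Rs) (length Os) n′ ⟩
      suc (length Rs + length Os) + suc n′
        ≡⟨ cong (_+ suc n′) length≡ ⟩
      k + suc n′ ∎
      where
      open ≡-Reasoning
      rearrange : ∀ a c m → suc (suc a + (c + m)) ≡ suc (a + c) + suc m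
      rearrange = ℕ-Solver.solve-∀

    BalancedCover-⊕ : BalancedCover (C r ⊕ G) (k + suc n′)
    BalancedCover-⊕ = record
      { P           = δ J V.++ P
      ; Q           = δ K V.++ Q
      ; Rs          = map glue R′
      ; Os          = map glue O′
      ; PQ-disjoint = glue-disjoint {s = s₀} (≡ᵇ-distinct (ℕₚ.1+n≢n ∘ sym) ∘ toℕ) PQ-disjoint
      ; Rs-disjoint = All.map⁺ (glue-disjoint {s = s₁} s₁-disjoint (λ v → ∧-zeroʳ (Q v))
                                ∷ All.map⁺ (All.map (glue-disjoint (λ v → ∧-zeroʳ (δ K v))) Rs-disjoint))
      ; Os-disjoint = All.map⁺ (All.++⁺ (All.map⁺ (All.map (glue-disjoint (λ _ → refl)) Os-disjoint))
                                        (All.map⁺ (All.map (λ d → glue-disjoint d (λ _ → refl)) (rungs-disjoint n′))))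
      ; represents  = subst (Represents (C r ⊕ G) ∘ (glue s₀ ∷_)) (LP.map-++ glue R′ O′)
                            (glue-represents S gadget-represents-cycle gadget-represents-rest gadget-cross≡false)
      ; balanced    = gadget-balanced
      ; length≡     = gadget-length
      }
      where
      s₁-disjoint : Disjoint (δ {r} 0 , δ₂ J K)
      s₁-disjoint v = trans (∧-distribˡ-xor (δ 0 v) (δ J v) (δ K v))
                            (cong₂ _xor_ (≡ᵇ-distinct (λ ()) (toℕ v)) (≡ᵇ-distinct (λ ()) (toℕ v)))

module EvenCycle (m′ : ℕ) where
  open Cycle (suc (2 * m′)) public

  Null-vanishes : ∀ w → Null (C r) w → w zero ≡ false → w (suc zero) ≡ false → ∀ v → w v ≡ false
  Null-vanishes w null w0≡false w1≡false v with Null-two-valued w null (toℕ v) (Finₚ.toℕ<n v)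
  ... | inj₁ wv≡w0 = trans (sym (at-toℕ w v)) (trans wv≡w0 (trans (at-toℕ w zero) w0≡false))
  ... | inj₂ wv≡w1 = trans (sym (at-toℕ w v)) (trans wv≡w1 (trans (at-toℕ w (suc zero)) w1≡false))

  nullFree : NullFree (C r) (2 + 2 * m′)
  nullFree = skip 2 , λ c null j → Null-vanishes (extend (skip 2) c) null refl refl (suc (suc j))

  oddCover : OddCover (C r) (suc m′)
  oddCover = record
    { bicliques  = rungs (suc m′)
    ; disjoint   = rungs-disjoint (suc m′)
    ; represents = λ u v _ → trans (form-rungs (suc m′) u v)
                     (trans (cong (λ i → path (suc i) u v xor edge 0 (suc i) u v) (ℕₚ.*-suc 2 m′)) (sym (adj≡path⊕edge u v)))
    ; length≡    = length-rungs (suc m′)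
    }

-- Unions of cycles

oddCycle evenCycle : ℕ → Graph
oddCycle n = C (suc (2 * n))
evenCycle m = C (2 * m)

Cycles : List ℕ → List ℕ → Graph
Cycles ns ms = ⨁ (map oddCycle ns ++ map evenCycle ms)

excess : List ℕ → ℕ
excess ms = sum ms ∸ length ms

length≤sum : ∀ ms → All (2 ≤_) ms → length ms ≤ sum ms
length≤sum []       []         = ℕ.z≤n
length≤sum (m ∷ ms) (2≤m ∷ hs) = ℕₚ.+-mono-≤ (ℕₚ.≤-trans (ℕ.s≤s ℕ.z≤n) 2≤m) (length≤sum ms hs)

excess-∷ : ∀ m′ ms → All (2 ≤_) ms → excess (suc (suc m′) ∷ ms) ≡ suc m′ + excess ms
excess-∷ m′ ms hs = ℕₚ.+-∸-assoc (suc m′) (length≤sum ms hs)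

odd-size : ∀ n′ → 2 + 2 * n′ ≡ 2 * suc n′
odd-size n′ = sym (ℕₚ.*-suc 2 n′)

even-size : ∀ m′ → 4 + 2 * m′ ≡ 2 * suc (suc m′)
even-size m′ = sym (trans (ℕₚ.*-suc 2 (suc m′)) (cong (2 +_) (ℕₚ.*-suc 2 m′)))

irreflexive-cycles : ∀ ns ms → All (1 ≤_) ns → All (2 ≤_) ms → Irreflexive (Cycles ns ms)
irreflexive-cycles [] [] [] [] = λ ()
irreflexive-cycles [] (suc (suc m′) ∷ ms) [] (ℕ.s≤s (ℕ.s≤s ℕ.z≤n) ∷ hs) =
  Irreflexive-⊕ (evenCycle (suc (suc m′))) (Cycles [] ms)
    (subst (Irreflexive ∘ C) (even-size m′) (EvenCycle.irreflexive m′)) (irreflexive-cycles [] ms [] hs)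
irreflexive-cycles (suc n′ ∷ ns) ms (ℕ.s≤s ℕ.z≤n ∷ hn) hm =
  Irreflexive-⊕ (oddCycle (suc n′)) (Cycles ns ms)
    (subst (Irreflexive ∘ C ∘ suc) (odd-size n′) (OddCycle.irreflexive n′)) (irreflexive-cycles ns ms hn hm)

nullFree-cycles : ∀ ns ms → All (1 ≤_) ns → All (2 ≤_) ms →
  NullFree (Cycles ns ms) (2 * (sum ns + excess ms))
nullFree-cycles [] [] [] [] = (λ ()) , λ c _ ()
nullFree-cycles [] (suc (suc m′) ∷ ms) [] (ℕ.s≤s (ℕ.s≤s ℕ.z≤n) ∷ hs) =
  subst (NullFree (Cycles [] (suc (suc m′) ∷ ms)))
        (trans (sym (ℕₚ.*-distribˡ-+ 2 (suc m′) (excess ms))) (cong (2 *_) (sym (excess-∷ m′ ms hs))))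
        (NullFree-⊕ (evenCycle (suc (suc m′))) (Cycles [] ms)
          (subst₂ (λ s p → NullFree (C s) p) (even-size m′) (odd-size m′) (EvenCycle.nullFree m′))
          (nullFree-cycles [] ms [] hs))
nullFree-cycles (suc n′ ∷ ns) ms (ℕ.s≤s ℕ.z≤n ∷ hn) hm =
  subst (NullFree (Cycles (suc n′ ∷ ns) ms))
        (trans (sym (ℕₚ.*-distribˡ-+ 2 (suc n′) (sum ns + excess ms)))
               (cong (2 *_) (sym (ℕₚ.+-assoc (suc n′) (sum ns) (excess ms)))))
        (NullFree-⊕ (oddCycle (suc n′)) (Cycles ns ms)
          (subst (λ s → NullFree (C (suc s)) s) (odd-size n′) (OddCycle.nullFree n′))
          (nullFree-cycles ns ms hn hm))

lowerBound : ∀ n ns ms → 1 ≤ n → All (1 ≤_) ns → All (2 ≤_) ms →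
  ∀ Bs → IsOddCover (Cycles (n ∷ ns) ms) Bs → suc (sum (n ∷ ns) + excess ms) ≤ length Bs
lowerBound (suc n′) ns ms (ℕ.s≤s ℕ.z≤n) hn hm Bs cover =
  ℕₚ.*-cancelˡ-< 2 _ _ (subst (_≤ 2 * length Bs) dimension (EvenNullFree⇒≤2*length irreflexive ℱ Bs cover))
  where
  irreflexive : Irreflexive (Cycles (suc n′ ∷ ns) ms)
  irreflexive = irreflexive-cycles (suc n′ ∷ ns) ms (ℕ.s≤s ℕ.z≤n ∷ hn) hm
  ℱ : EvenNullFree (Cycles (suc n′ ∷ ns) ms) (suc (2 * suc n′) + 2 * (sum ns + excess ms))
  ℱ = EvenNullFree-⊕ (oddCycle (suc n′)) (Cycles ns ms)
        (subst (λ s → EvenNullFree (C s) s) (cong suc (odd-size n′)) (OddCycle.evenNullFree n′))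
        (nullFree-cycles ns ms hn hm)
  dimension : suc (2 * suc n′) + 2 * (sum ns + excess ms) ≡ suc (2 * (suc n′ + sum ns + excess ms))
  dimension = cong suc (trans (sym (ℕₚ.*-distribˡ-+ 2 (suc n′) (sum ns + excess ms)))
                              (cong (2 *_) (sym (ℕₚ.+-assoc (suc n′) (sum ns) (excess ms)))))

oddCover-evens : ∀ ms → All (2 ≤_) ms → OddCover (Cycles [] ms) (excess ms)
oddCover-evens [] [] = record { bicliques = [] ; disjoint = [] ; represents = λ () ; length≡ = refl }
oddCover-evens (suc (suc m′) ∷ ms) (ℕ.s≤s (ℕ.s≤s ℕ.z≤n) ∷ hs) =
  subst (OddCover (Cycles [] (suc (suc m′) ∷ ms))) (sym (excess-∷ m′ ms hs))
        (OddCover-⊕ (subst (λ s → OddCover (C s) (suc m′)) (even-size m′) (EvenCycle.oddCover m′))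
                    (oddCover-evens ms hs))

balancedCover-cycles : ∀ ns ms → All (1 ≤_) ns → All (2 ≤_) ms →
  BalancedCover (Cycles ns ms) (suc (sum ns + excess ms))
balancedCover-cycles []            ms []                 hm = OddCover⇒BalancedCover (oddCover-evens ms hm)
balancedCover-cycles (suc n′ ∷ ns) ms (ℕ.s≤s ℕ.z≤n ∷ hn) hm =
  subst (BalancedCover (Cycles (suc n′ ∷ ns) ms)) (rearrange (sum ns) (excess ms) n′)
        (subst (λ s → BalancedCover (C s ⊕ Cycles ns ms) (suc (sum ns + excess ms) + suc n′))
               (cong suc (odd-size n′))
               (OddCycle.BalancedCover-⊕ n′ (balancedCover-cycles ns ms hn hm)))
  where
  rearrange : ∀ a c m → suc (a + c) + suc m ≡ suc (suc m + a + c)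
  rearrange = ℕ-Solver.solve-∀

upperBound : ∀ ns ms → All (1 ≤_) ns → All (2 ≤_) ms →
  Σ[ Bs ∈ List (Biclique (size (Cycles ns ms))) ] (IsOddCover (Cycles ns ms) Bs × length Bs ≡ suc (sum ns + excess ms))
upperBound ns ms hn hm = bicliques , represents⇒oddCover (All⇒AllDisjoint disjoint) represents , length≡
  where open OddCover (BalancedCover⇒OddCover (balancedCover-cycles ns ms hn hm))

theorem8 : (ns ms : List ℕ) → 1 ≤ length ns → All (1 ≤_) ns → All (2 ≤_) ms →
    b₂≡ (⨁ (map (λ n → C (suc (2 * n))) ns ++ map (λ m → C (2 * m)) ms))
        (sum ns + sum ms ∸ length ms + 1)
theorem8 []       ms ()  _          _
theorem8 (n ∷ ns) ms _   (1≤n ∷ hn) hm =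
  subst (b₂≡ (Cycles (n ∷ ns) ms)) (sym value) (upperBound (n ∷ ns) ms (1≤n ∷ hn) hm , lowerBound n ns ms 1≤n hn hm)
  where
  value : sum (n ∷ ns) + sum ms ∸ length ms + 1 ≡ suc (sum (n ∷ ns) + excess ms)
  value = trans (ℕₚ.+-comm _ 1) (cong suc (ℕₚ.+-∸-assoc (sum (n ∷ ns)) (length≤sum ms hm)))
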